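{- The family $\mathcal{S}=\bigcup_{k\ge1}\mathcal{S}_k$ equals the family $\{S(G):\ G \text{ is a tree}\}$, where $S(G)$ denotes the subdivision graph of $G$ (obtained by subdividing each edge of $G$ exactly once).
   Context: Families $\mathcal{S}_k$ of graphs (up to isomorphism), each $S\in\mathcal{S}_k$ equipped with a vertex subset $X(S)$, are defined recursively. $\mathcal{S}_1=\{P_1\}$ and $X(P_1)$ consists of the only vertex of $P_1$. For $k\ge 2$, $\mathcal{S}_k^*$ is the set of graphs obtained as follows: take two vertex-disjoint graphs $S^1\in\mathcal{S}_{k-1}$ and $S^2\in\bigcup_{i=1}^{k-1}\mathcal{S}_i$ and a new vertex $z_k$ (the origin vertex); choose $x^j\in X(S^j)$ for $j\in\{1,2\}$; make $z_k$ adjacent to $x^1$ and $x^2$; the resulting graph $S$ has $X(S)=X(S^1)\cup X(S^2)$. Then $\mathcal{S}_k=\mathcal{S}_k^*\setminus\bigcup_{i=1}^{k-1}\mathcal{S}_i$. The trivial tree $K_1$ is considered a tree, with $S(K_1)=K_1$. -}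

module Defs where

open import Level using (Lift) renaming (suc to lsuc; zero to lzero)
open import Data.Nat using (ℕ; zero; suc; _≤_)
open import Data.Fin using (Fin; _<_)
open import Data.Bool using (Bool; true; false)
open import Data.Unit using (⊤; tt)
open import Data.Empty using (⊥)
open import Data.Maybe using (Maybe; just; nothing)
open import Data.Sum using (_⊎_; inj₁; inj₂)
open import Data.Product using (Σ; _×_; _,_; Σ-syntax)
open import Data.List using (List; []; _∷_; length; _++_; [_])
open import Data.List.Relation.Unary.Linked using (Linked)
open import Data.List.Relation.Unary.Unique.Propositional using (Unique)
open import Function.Bundles using (_↔_; _⇔_; Inverse)
open import Relation.Binary.PropositionalEquality using (_≡_)
open import Relation.Nullary using (¬_)

record Graph : Set₁ where
  field
    V : Set
    E : V → V → Set

record LGraph : Set₁ where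
  field
    graph : Graph
    X     : Graph.V graph → Set
  open Graph graph public

record _≅_ (G H : Graph) : Set where
  field
    bij : Graph.V G ↔ Graph.V H
    adj : ∀ u v → Graph.E G u v ⇔ Graph.E H (Inverse.to bij u) (Inverse.to bij v)

record _≅ₗ_ (A B : LGraph) : Set where
  field
    iso : LGraph.graph A ≅ LGraph.graph B
    lab : ∀ u → LGraph.X A u ⇔ LGraph.X B (Inverse.to (_≅_.bij iso) u)

P₁ : LGraph
P₁ = record { graph = record { V = ⊤ ; E = λ _ _ → ⊥ } ; X = λ _ → ⊤ }

-- disjoint union of S¹ and S² plus a new origin vertex z (= nothing)
-- adjacent exactly to x¹ and x²; X = X(S¹) ∪ X(S²)
join : (S¹ S² : LGraph) → LGraph.V S¹ → LGraph.V S² → LGraph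
join S¹ S² x¹ x² = record { graph = record { V = Vj ; E = Ej } ; X = Xj }
  where
  Vj : Set
  Vj = Maybe (LGraph.V S¹ ⊎ LGraph.V S²)
  Ej : Vj → Vj → Set
  Ej nothing nothing = ⊥
  Ej nothing (just (inj₁ a)) = a ≡ x¹
  Ej nothing (just (inj₂ b)) = b ≡ x²
  Ej (just (inj₁ a)) nothing = a ≡ x¹
  Ej (just (inj₂ b)) nothing = b ≡ x²
  Ej (just (inj₁ a)) (just (inj₁ a')) = LGraph.E S¹ a a'
  Ej (just (inj₂ b)) (just (inj₂ b')) = LGraph.E S² b b'
  Ej (just (inj₁ _)) (just (inj₂ _)) = ⊥
  Ej (just (inj₂ _)) (just (inj₁ _)) = ⊥
  Xj : Vj → Set
  Xj nothing = ⊥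
  Xj (just (inj₁ a)) = LGraph.X S¹ a
  Xj (just (inj₂ b)) = LGraph.X S² b

-- S_k^* built from a family P (playing S_{k-1}) and Q (playing ⋃_{i<k} S_i),
-- closed under isomorphism
𝒮* : (LGraph → Set₁) → (LGraph → Set₁) → LGraph → Set₁
𝒮* P Q A =
  Σ[ S¹ ∈ LGraph ] Σ[ S² ∈ LGraph ] Σ[ x¹ ∈ LGraph.V S¹ ] Σ[ x² ∈ LGraph.V S² ]
    P S¹ × Q S² × LGraph.X S¹ x¹ × LGraph.X S² x² × (A ≅ₗ join S¹ S² x¹ x²)

mutual
  -- 𝒮 k A : A belongs (up to isomorphism) to S_k   (𝒮 0 is empty)
  𝒮 : ℕ → LGraph → Set₁
  𝒮 zero A = Lift (lsuc lzero) ⊥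
  𝒮 (suc zero) A = Lift (lsuc lzero) (A ≅ₗ P₁)
  𝒮 (suc (suc k)) A = 𝒮* (𝒮 (suc k)) (Below (suc (suc k))) A × ¬ Below (suc (suc k)) A

  -- Below k A : A ∈ ⋃_{1 ≤ i < k} S_i
  Below : ℕ → LGraph → Set₁
  Below zero A = Lift (lsuc lzero) ⊥
  Below (suc k) A = Below k A ⊎ 𝒮 k A

AdjMat : ℕ → Set
AdjMat n = Fin n → Fin n → Bool

toGraph : ∀ {n} → AdjMat n → Graph
toGraph {n} g = record { V = Fin n ; E = λ u v → g u v ≡ true }

IsSimple : ∀ {n} → AdjMat n → Set
IsSimple {n} g = (∀ u v → g u v ≡ g v u) × (∀ u → g u u ≡ false)

data Walk (G : Graph) : Graph.V G → Graph.V G → Set where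
  here : ∀ {u} → Walk G u u
  step : ∀ {u v w} → Graph.E G u v → Walk G v w → Walk G u w

Connected : Graph → Set
Connected G = ∀ u v → Walk G u v

HasCycle : Graph → Set
HasCycle G = Σ[ v ∈ Graph.V G ] Σ[ vs ∈ List (Graph.V G) ]
  (2 ≤ length vs) × Unique (v ∷ vs) × Linked (Graph.E G) (v ∷ vs ++ [ v ])

IsTree : ∀ {n} → AdjMat n → Set
IsTree {n} g = IsSimple g × (1 ≤ n) × Connected (toGraph g) × ¬ HasCycle (toGraph g)

-- subdivision graph S(T): vertices of T plus one new vertex per edge {u,v}
-- (represented with u < v), the new vertex adjacent to exactly u and v
Subdivision : ∀ {n} → AdjMat n → Graph
Subdivision {n} g = record { V = SV ; E = SE }
  where
  EdgeV : Set
  EdgeV = Σ[ u ∈ Fin n ] Σ[ v ∈ Fin n ] (u < v) × (g u v ≡ true)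
  SV : Set
  SV = Fin n ⊎ EdgeV
  SE : SV → SV → Set
  SE (inj₁ w) (inj₂ (u , v , _)) = (w ≡ u) ⊎ (w ≡ v)
  SE (inj₂ (u , v , _)) (inj₁ w) = (w ≡ u) ⊎ (w ≡ v)
  SE (inj₁ _) (inj₁ _) = ⊥
  SE (inj₂ _) (inj₂ _) = ⊥

In𝒮 : ∀ {m} → AdjMat m → Set₁
In𝒮 {m} g = Σ[ k ∈ ℕ ] Σ[ X ∈ (Fin m → Set) ] 𝒮 k (record { graph = toGraph g ; X = X })

IsSubdivOfTree : ∀ {m} → AdjMat m → Set
IsSubdivOfTree g = Σ[ n ∈ ℕ ] Σ[ t ∈ AdjMat n ] IsTree t × (toGraph g ≅ Subdivision t)

-- Both directions go by induction, with X always the set of original vertices of the subdivision.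
-- Joining S(T₁) and S(T₂) through a new origin vertex adjacent to original vertices a and b gives
-- S(T), where T is T₁ and T₂ joined by the edge ab; so every member of S is the subdivision of a tree.
-- Conversely, a tree T with at least two vertices has a leaf l with neighbour p, and S(T) is the join
-- of S(T − l) at p with S(K₁) = P₁, the subdivision vertex of the edge lp being the origin.
-- Since S_k excludes the lower S_i, this membership must also be decided: a finite graph is a join in
-- only finitely many ways (choices of origin, attachment vertices and sides of the other vertices).

module Submission where

open import Defs
open import Axiom.UniquenessOfIdentityProofs.WithK using (uip)
open import Level using (lift; lower)
open import Data.Bool using (Bool; true; false; T; _∧_)
open import Data.Bool.Properties using (¬-not; T-≡; T-∧; ∧-comm; ∧-identityʳ; ⇔→≡) renaming (_≟_ to _≟ᵇ_)
open import Data.Empty using (⊥; ⊥-elim)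
open import Data.Fin using (Fin; zero; suc; splitAt; punchIn; punchOut) renaming (_<_ to _<ᶠ_)
open import Data.Fin.Properties
  using (all?; any?; <-cmp; <-asym; +↔⊎; injective⇒≤; punchIn-injective; punchIn-punchOut; punchOut-punchIn;
         punchOut-cong; punchOut-injective; punchInᵢ≢i)
  renaming (_≟_ to _≟ᶠ_)
open import Data.List as List using (List; []; _∷_; length; _++_; [_])
open import Data.List.Properties using (length-map; map-++; ++-assoc; ++-identityʳ)
open import Data.List.Membership.Propositional using (_∈_; find; lose)
open import Data.List.Membership.Propositional.Properties using (∈-∃++; ∈-++⁻; ∈-lookup)
open import Data.List.Relation.Binary.Permutation.Propositional using (_↭_; ↭⇒↭ₛ)
open import Data.List.Relation.Binary.Permutation.Propositional.Properties
  using (∈-resp-↭; ↭-length; ++-comm; shift)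
import Data.List.Relation.Binary.Permutation.Setoid.Properties as Permutation
open import Data.List.Relation.Unary.All as All using ([]; _∷_)
open import Data.List.Relation.Unary.All.Properties using (All¬⇒¬Any; ¬Any⇒All¬; ++⁻ˡ)
open import Data.List.Relation.Unary.AllPairs using ([]; _∷_)
open import Data.List.Relation.Unary.Any as Any using (Any; here; there)
open import Data.List.Relation.Unary.Any.Properties using (++⁺ʳ)
open import Data.List.Relation.Unary.Linked as Linked using (Linked; []; [-]; _∷_)
import Data.List.Relation.Unary.Linked.Properties as Linked
open import Data.List.Relation.Unary.Unique.Propositional using (Unique)
import Data.List.Relation.Unary.Unique.Propositional.Properties as Unique
open import Data.List.Relation.Unary.Unique.Propositional.Properties using (Unique[x∷xs]⇒x∉xs)
open import Data.Maybe using (Maybe; just; nothing; is-just)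
open import Data.Nat using (ℕ; zero; suc; _+_; _≤_; _<_; z≤n; s≤s)
open import Data.Nat.Properties using (suc-injective; <-irrelevant; <⇒≱; +-suc; m<m+n)
open import Data.Product using (Σ; _×_; _,_; Σ-syntax; proj₁; proj₂) renaming (map to map×)
open import Data.Sum using (_⊎_; inj₁; inj₂; isInj₁; isInj₂) renaming (map to map⊎; swap to swap⊎)
open import Data.Sum.Properties using (inj₁-injective; inj₂-injective; swap-↔)
open import Data.Unit using (tt)
open import Data.Vec using (Vec; []; _∷_; lookup; map; tabulate)
open import Data.Vec.Properties using (lookup-map; lookup∘tabulate)
open import Function.Base using (id; _∘_; case_of_)
open import Function.Bundles using (_↔_; _⇔_; Inverse; Equivalence; Injection; mk↔ₛ′; mk⇔)
open import Function.Construct.Composition using (_↔-∘_; _⇔-∘_)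
open import Function.Construct.Identity using (⇔-id)
open import Function.Construct.Symmetry using (↔-sym; ⇔-sym)
open import Function.Properties.Inverse using (↔⇒↣)
open import Relation.Binary.Definitions using (DecidableEquality; tri<; tri≈; tri>)
open import Relation.Binary.PropositionalEquality
  using (_≡_; _≢_; setoid; refl; sym; trans; cong; cong₂; subst; subst₂)
open import Relation.Nullary using (¬_; Dec; yes; no)
open import Relation.Nullary.Decidable
  using (isYes; map′; _×-dec_; _⊎-dec_; _→-dec_; ¬?; T?; toWitness; fromWitness)

open Inverse using (to; from; strictlyInverseˡ; strictlyInverseʳ)
open _≅_ using (bij; adj)
open _≅ₗ_ using (iso; lab)

to-injective : ∀ {A B : Set} (b : A ↔ B) {x y} → to b x ≡ to b y → x ≡ y
to-injective b = Injection.injective (↔⇒↣ b)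

≅-trans : {G H K : Graph} → G ≅ H → H ≅ K → G ≅ K
≅-trans p q = record
  { bij = bij q ↔-∘ bij p
  ; adj = λ u v → adj q _ _ ⇔-∘ adj p u v }

≅-sym : {G H : Graph} → G ≅ H → H ≅ G
≅-sym {G} {H} p = record
  { bij = ↔-sym (bij p)
  ; adj = λ u v → ⇔-sym (subst₂ (λ x y → Graph.E G (from′ u) (from′ v) ⇔ Graph.E H x y)
                                (strictlyInverseˡ (bij p) u) (strictlyInverseˡ (bij p) v)
                                (adj p _ _)) }
  where from′ = from (bij p)

≅ₗ-trans : {A B C : LGraph} → A ≅ₗ B → B ≅ₗ C → A ≅ₗ C
≅ₗ-trans p q = record
  { iso = ≅-trans (iso p) (iso q)
  ; lab = λ u → lab q _ ⇔-∘ lab p u }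

≅ₗ-sym : {A B : LGraph} → A ≅ₗ B → B ≅ₗ A
≅ₗ-sym {A} {B} p = record
  { iso = ≅-sym (iso p)
  ; lab = λ u → ⇔-sym (subst (λ x → LGraph.X A (from′ u) ⇔ LGraph.X B x)
                             (strictlyInverseˡ (bij (iso p)) u) (lab p _)) }
  where from′ = from (bij (iso p))

mutual
  𝒮-resp-≅ₗ : ∀ k {A B} → 𝒮 k A → A ≅ₗ B → 𝒮 k B
  𝒮-resp-≅ₗ zero (lift ()) _
  𝒮-resp-≅ₗ (suc zero) (lift p) q = lift (≅ₗ-trans (≅ₗ-sym q) p)
  𝒮-resp-≅ₗ (suc (suc k)) ((S¹ , S² , x¹ , x² , p , q , a , b , i) , A∉) r =
    (S¹ , S² , x¹ , x² , p , q , a , b , ≅ₗ-trans (≅ₗ-sym r) i) ,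
    λ B∈ → A∉ (Below-resp-≅ₗ (suc (suc k)) B∈ (≅ₗ-sym r))

  Below-resp-≅ₗ : ∀ k {A B} → Below k A → A ≅ₗ B → Below k B
  Below-resp-≅ₗ zero (lift ()) _
  Below-resp-≅ₗ (suc k) (inj₁ b) r = inj₁ (Below-resp-≅ₗ k b r)
  Below-resp-≅ₗ (suc k) (inj₂ s) r = inj₂ (𝒮-resp-≅ₗ k s r)

module _ {S¹ T¹ S² T² : LGraph} (p : S¹ ≅ₗ T¹) (q : S² ≅ₗ T²)
         (x¹ : LGraph.V S¹) (x² : LGraph.V S²) where
  private
    β¹ = bij (iso p)
    β² = bij (iso q)
    J  = join S¹ S² x¹ x²
    J′ = join T¹ T² (to β¹ x¹) (to β² x²)

    f : LGraph.V J → LGraph.V J′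
    f nothing         = nothing
    f (just (inj₁ a)) = just (inj₁ (to β¹ a))
    f (just (inj₂ b)) = just (inj₂ (to β² b))

    f⁻¹ : LGraph.V J′ → LGraph.V J
    f⁻¹ nothing         = nothing
    f⁻¹ (just (inj₁ a)) = just (inj₁ (from β¹ a))
    f⁻¹ (just (inj₂ b)) = just (inj₂ (from β² b))

    ff⁻¹ : ∀ y → f (f⁻¹ y) ≡ y
    ff⁻¹ nothing         = refl
    ff⁻¹ (just (inj₁ a)) = cong (just ∘ inj₁) (strictlyInverseˡ β¹ a)
    ff⁻¹ (just (inj₂ b)) = cong (just ∘ inj₂) (strictlyInverseˡ β² b)

    f⁻¹f : ∀ x → f⁻¹ (f x) ≡ x
    f⁻¹f nothing         = refl
    f⁻¹f (just (inj₁ a)) = cong (just ∘ inj₁) (strictlyInverseʳ β¹ a)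
    f⁻¹f (just (inj₂ b)) = cong (just ∘ inj₂) (strictlyInverseʳ β² b)

    f-adj : ∀ u v → LGraph.E J u v ⇔ LGraph.E J′ (f u) (f v)
    f-adj nothing          nothing          = ⇔-id _
    f-adj nothing          (just (inj₁ a))  = mk⇔ (cong (to β¹)) (to-injective β¹)
    f-adj nothing          (just (inj₂ b))  = mk⇔ (cong (to β²)) (to-injective β²)
    f-adj (just (inj₁ a))  nothing          = mk⇔ (cong (to β¹)) (to-injective β¹)
    f-adj (just (inj₂ b))  nothing          = mk⇔ (cong (to β²)) (to-injective β²)
    f-adj (just (inj₁ a))  (just (inj₁ a′)) = adj (iso p) a a′
    f-adj (just (inj₂ b))  (just (inj₂ b′)) = adj (iso q) b b′
    f-adj (just (inj₁ _))  (just (inj₂ _))  = ⇔-id _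
    f-adj (just (inj₂ _))  (just (inj₁ _))  = ⇔-id _

    f-lab : ∀ u → LGraph.X J u ⇔ LGraph.X J′ (f u)
    f-lab nothing         = ⇔-id _
    f-lab (just (inj₁ a)) = lab p a
    f-lab (just (inj₂ b)) = lab q b

  join-cong : J ≅ₗ J′
  join-cong = record { iso = record { bij = mk↔ₛ′ f f⁻¹ ff⁻¹ f⁻¹f ; adj = f-adj } ; lab = f-lab }

count : ∀ {m} → Vec Bool m → ℕ
count []          = 0
count (true ∷ v)  = suc (count v)
count (false ∷ v) = count v

embed : ∀ {m} (v : Vec Bool m) → Fin (count v) → Fin m
embed (true ∷ v)  zero    = zero
embed (true ∷ v)  (suc a) = suc (embed v a)
embed (false ∷ v) a       = suc (embed v a)

embed-marked : ∀ {m} (v : Vec Bool m) a → T (lookup v (embed v a))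
embed-marked (true ∷ v)  zero    = _
embed-marked (true ∷ v)  (suc a) = embed-marked v a
embed-marked (false ∷ v) a       = embed-marked v a

index : ∀ {m} (v : Vec Bool m) i → .(T (lookup v i)) → Fin (count v)
index (true ∷ v)  zero    _ = zero
index (true ∷ v)  (suc i) p = suc (index v i p)
index (false ∷ v) (suc i) p = index v i p

embed-index : ∀ {m} (v : Vec Bool m) i .p → embed v (index v i p) ≡ i
embed-index (true ∷ v)  zero    _ = refl
embed-index (true ∷ v)  (suc i) p = cong suc (embed-index v i p)
embed-index (false ∷ v) (suc i) p = cong suc (embed-index v i p)

index-embed : ∀ {m} (v : Vec Bool m) a .p → index v (embed v a) p ≡ a
index-embed (true ∷ v)  zero    _ = refl
index-embed (true ∷ v)  (suc a) p = cong suc (index-embed v a p)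
index-embed (false ∷ v) a       p = index-embed v a p

index-cong : ∀ {m} (v : Vec Bool m) {i j} .p .q → i ≡ j → index v i p ≡ index v j q
index-cong v _ _ refl = refl

embed≡⇒≡index : ∀ {m} (v : Vec Bool m) a {i} .p → embed v a ≡ i → a ≡ index v i p
embed≡⇒≡index v a p e = trans (sym (index-embed v a (embed-marked v a))) (index-cong v _ p e)

labelled : ∀ {m} → AdjMat m → (Fin m → Bool) → LGraph
labelled g X = record { graph = toGraph g ; X = T ∘ X }

restrict : ∀ {m} → AdjMat m → (Fin m → Bool) → Vec Bool m → LGraph
restrict g X v = labelled (λ a b → g (embed v a) (embed v b)) (X ∘ embed v)

-- Deciding membership in S_k

data Side : Set where
  origin left right : Side

_≟ˢ_ : DecidableEquality Side
origin ≟ˢ origin = yes refl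
left   ≟ˢ left   = yes refl
right  ≟ˢ right  = yes refl
origin ≟ˢ left   = no λ ()
origin ≟ˢ right  = no λ ()
left   ≟ˢ origin = no λ ()
left   ≟ˢ right  = no λ ()
right  ≟ˢ origin = no λ ()
right  ≟ˢ left   = no λ ()

select : ∀ {m} → Side → Vec Side m → Vec Bool m
select c = map (λ d → isYes (d ≟ˢ c))

selected : ∀ {m} c (s : Vec Side m) i → lookup s i ≡ c → T (lookup (select c s) i)
selected c s i e = subst T (sym (lookup-map i _ s)) (fromWitness {a? = lookup s i ≟ˢ c} e)

selected⁻¹ : ∀ {m} c (s : Vec Side m) i → T (lookup (select c s) i) → lookup s i ≡ c
selected⁻¹ c s i p = toWitness {a? = lookup s i ≟ˢ c} (subst T (lookup-map i _ s) p)

side-embed : ∀ {m} c (s : Vec Side m) a → lookup s (embed (select c s) a) ≡ c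
side-embed c s a = selected⁻¹ c s _ (embed-marked (select c s) a)

module _ {m} (g : AdjMat m) (X : Fin m → Bool) where

  part : Side → Vec Side m → LGraph
  part c s = restrict g X (select c s)

  -- z is the origin vertex, s assigns every vertex to the origin or to one of the two parts,
  -- and x₁, x₂ are the vertices of the two parts adjacent to z
  record Splitting (z : Fin m) (s : Vec Side m) (x₁ x₂ : Fin m) : Set where
    constructor mkSplitting
    field
      z-origin      : lookup s z ≡ origin
      origin-unique : ∀ i → lookup s i ≡ origin → i ≡ z
      x₁-left       : lookup s x₁ ≡ left
      x₂-right      : lookup s x₂ ≡ right
      z→x₁          : g z x₁ ≡ true
      z→x₂          : g z x₂ ≡ true
      x₁→z          : g x₁ z ≡ true
      x₂→z          : g x₂ z ≡ true
      z→-only       : ∀ w → g z w ≡ true → w ≡ x₁ ⊎ w ≡ x₂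
      →z-only       : ∀ w → g w z ≡ true → w ≡ x₁ ⊎ w ≡ x₂
      left↛right    : ∀ i j → lookup s i ≡ left → lookup s j ≡ right → g i j ≡ false
      right↛left    : ∀ i j → lookup s i ≡ right → lookup s j ≡ left → g i j ≡ false
      z∉X           : ¬ T (X z)
      x₁∈X          : T (X x₁)
      x₂∈X          : T (X x₂)

  splitting? : ∀ z s x₁ x₂ → Dec (Splitting z s x₁ x₂)
  splitting? z s x₁ x₂ = map′ fromTuple toTuple
    ( (lookup s z ≟ˢ origin)
    ×-dec all? (λ i → (lookup s i ≟ˢ origin) →-dec (i ≟ᶠ z))
    ×-dec (lookup s x₁ ≟ˢ left) ×-dec (lookup s x₂ ≟ˢ right)
    ×-dec (g z x₁ ≟ᵇ true) ×-dec (g z x₂ ≟ᵇ true) ×-dec (g x₁ z ≟ᵇ true) ×-dec (g x₂ z ≟ᵇ true)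
    ×-dec all? (λ w → (g z w ≟ᵇ true) →-dec ((w ≟ᶠ x₁) ⊎-dec (w ≟ᶠ x₂)))
    ×-dec all? (λ w → (g w z ≟ᵇ true) →-dec ((w ≟ᶠ x₁) ⊎-dec (w ≟ᶠ x₂)))
    ×-dec all? (λ i → all? (λ j → (lookup s i ≟ˢ left) →-dec ((lookup s j ≟ˢ right) →-dec (g i j ≟ᵇ false))))
    ×-dec all? (λ i → all? (λ j → (lookup s i ≟ˢ right) →-dec ((lookup s j ≟ˢ left) →-dec (g i j ≟ᵇ false))))
    ×-dec ¬? (T? (X z)) ×-dec T? (X x₁) ×-dec T? (X x₂))
    where
    fromTuple = λ (a , b , c , d , e , f , g , h , i , j , k , l , m , n , o) →
                  mkSplitting a b c d e f g h i j k l m n o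
    toTuple   = λ (σ : Splitting z s x₁ x₂) → let open Splitting σ in
                  z-origin , origin-unique , x₁-left , x₂-right , z→x₁ , z→x₂ , x₁→z , x₂→z ,
                  z→-only , →z-only , left↛right , right↛left , z∉X , x₁∈X , x₂∈X

  module FromSplitting {z s x₁ x₂} (σ : Splitting z s x₁ x₂) where
    open Splitting σ

    private
      vL = select left s
      vR = select right s

    y₁ : Fin (count vL)
    y₁ = index vL x₁ (selected left s x₁ x₁-left)

    y₂ : Fin (count vR)
    y₂ = index vR x₂ (selected right s x₂ x₂-right)

    private
      J = join (part left s) (part right s) y₁ y₂
      O = LGraph.V J

      classify : ∀ i c → lookup s i ≡ c → O
      classify i origin _ = nothing
      classify i left   e = just (inj₁ (index vL i (selected left s i e)))
      classify i right  e = just (inj₂ (index vR i (selected right s i e)))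

      f : Fin m → O
      f i = classify i (lookup s i) refl

      f≡classify : ∀ i c (e : lookup s i ≡ c) → f i ≡ classify i c e
      f≡classify i _ refl = refl

      h : O → Fin m
      h nothing         = z
      h (just (inj₁ a)) = embed vL a
      h (just (inj₂ b)) = embed vR b

      hf : ∀ i → h (f i) ≡ i
      hf i = by-side (lookup s i) refl
        where
        by-side : ∀ c (e : lookup s i ≡ c) → h (f i) ≡ i
        by-side origin e = trans (cong h (f≡classify i origin e)) (sym (origin-unique i e))
        by-side left   e = trans (cong h (f≡classify i left e)) (embed-index vL i _)
        by-side right  e = trans (cong h (f≡classify i right e)) (embed-index vR i _)

      fh : ∀ o → f (h o) ≡ o
      fh nothing         = f≡classify z origin z-origin
      fh (just (inj₁ a)) = trans (f≡classify _ left (side-embed left s a))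
                                 (cong (just ∘ inj₁) (index-embed vL a _))
      fh (just (inj₂ b)) = trans (f≡classify _ right (side-embed right s b))
                                 (cong (just ∘ inj₂) (index-embed vR b _))

      left≢right : ∀ {i j} → lookup s i ≡ left → lookup s j ≡ right → i ≢ j
      left≢right eᵢ eⱼ refl with trans (sym eᵢ) eⱼ
      ... | ()

      attached-left : {R : Fin m → Set} → R x₁ → (∀ w → R w → w ≡ x₁ ⊎ w ≡ x₂) →
                      ∀ a → (a ≡ y₁) ⇔ R (embed vL a)
      attached-left {R} Rx₁ only a = mk⇔
        (λ e → subst R (sym (trans (cong (embed vL) e) (embed-index vL x₁ _))) Rx₁)
        (λ Rw → case only _ Rw of λ
          { (inj₁ e) → embed≡⇒≡index vL a _ e
          ; (inj₂ e) → ⊥-elim (left≢right (side-embed left s a) x₂-right e) })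

      attached-right : {R : Fin m → Set} → R x₂ → (∀ w → R w → w ≡ x₁ ⊎ w ≡ x₂) →
                       ∀ b → (b ≡ y₂) ⇔ R (embed vR b)
      attached-right {R} Rx₂ only b = mk⇔
        (λ e → subst R (sym (trans (cong (embed vR) e) (embed-index vR x₂ _))) Rx₂)
        (λ Rw → case only _ Rw of λ
          { (inj₁ e) → ⊥-elim (left≢right x₁-left (side-embed right s b) (sym e))
          ; (inj₂ e) → embed≡⇒≡index vR b _ e })

      no-loop : ¬ g z z ≡ true
      no-loop e = case z→-only z e of λ
        { (inj₁ e) → case trans (sym z-origin) (trans (cong (lookup s) e) x₁-left) of λ ()
        ; (inj₂ e) → case trans (sym z-origin) (trans (cong (lookup s) e) x₂-right) of λ () }

      h-adj : ∀ o o′ → LGraph.E J o o′ ⇔ (g (h o) (h o′) ≡ true)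
      h-adj nothing          nothing          = mk⇔ ⊥-elim no-loop
      h-adj nothing          (just (inj₁ a))  = attached-left z→x₁ z→-only a
      h-adj nothing          (just (inj₂ b))  = attached-right z→x₂ z→-only b
      h-adj (just (inj₁ a))  nothing          = attached-left x₁→z →z-only a
      h-adj (just (inj₂ b))  nothing          = attached-right x₂→z →z-only b
      h-adj (just (inj₁ _))  (just (inj₁ _))  = ⇔-id _
      h-adj (just (inj₂ _))  (just (inj₂ _))  = ⇔-id _
      h-adj (just (inj₁ a))  (just (inj₂ b))  = mk⇔ ⊥-elim λ e →
        case trans (sym e) (left↛right _ _ (side-embed left s a) (side-embed right s b)) of λ ()
      h-adj (just (inj₂ b))  (just (inj₁ a))  = mk⇔ ⊥-elim λ e →
        case trans (sym e) (right↛left _ _ (side-embed right s b) (side-embed left s a)) of λ ()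

      h-lab : ∀ o → LGraph.X J o ⇔ T (X (h o))
      h-lab nothing         = mk⇔ ⊥-elim z∉X
      h-lab (just (inj₁ _)) = ⇔-id _
      h-lab (just (inj₂ _)) = ⇔-id _

    splitting-≅ₗ : labelled g X ≅ₗ J
    splitting-≅ₗ = ≅ₗ-sym record
      { iso = record { bij = mk↔ₛ′ h f hf fh ; adj = h-adj } ; lab = h-lab }

    y₁∈X : LGraph.X (part left s) y₁
    y₁∈X = subst (T ∘ X) (sym (embed-index vL x₁ _)) x₁∈X

    y₂∈X : LGraph.X (part right s) y₂
    y₂∈X = subst (T ∘ X) (sym (embed-index vR x₂ _)) x₂∈X

  splitting⇒𝒮* : (P Q : LGraph → Set₁) → ∀ {z s x₁ x₂} → Splitting z s x₁ x₂ →
                 P (part left s) → Q (part right s) → 𝒮* P Q (labelled g X)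
  splitting⇒𝒮* P Q σ p q = _ , _ , y₁ , y₂ , p , q , y₁∈X , y₂∈X , splitting-≅ₗ
    where open FromSplitting σ

  module ToSplitting {S¹ S² : LGraph} {y₁ : LGraph.V S¹} {y₂ : LGraph.V S²}
                     (φ : labelled g X ≅ₗ join S¹ S² y₁ y₂)
                     (y₁∈X : LGraph.X S¹ y₁) (y₂∈X : LGraph.X S² y₂) where
    private
      J = join S¹ S² y₁ y₂
      O = LGraph.V J
      ψ = ≅ₗ-sym φ
      β = bij (iso ψ)

      h : O → Fin m
      h = to β

      h-adj : ∀ o o′ → LGraph.E J o o′ ⇔ (g (h o) (h o′) ≡ true)
      h-adj = adj (iso ψ)

      h-lab : ∀ o → LGraph.X J o ⇔ T (X (h o))
      h-lab = lab ψ

      via-h : {R : Fin m → Set} → (∀ o → R (h o)) → ∀ w → R w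
      via-h {R} r w = subst R (strictlyInverseˡ β w) (r (from β w))

      side : O → Side
      side nothing         = origin
      side (just (inj₁ _)) = left
      side (just (inj₂ _)) = right

    s : Vec Side m
    s = tabulate (side ∘ from β)

    z x₁ x₂ : Fin m
    z  = h nothing
    x₁ = h (just (inj₁ y₁))
    x₂ = h (just (inj₂ y₂))

    private
      side-h : ∀ o → lookup s (h o) ≡ side o
      side-h o = trans (lookup∘tabulate _ (h o)) (cong side (strictlyInverseʳ β o))

      side-of : ∀ o {c} → lookup s (h o) ≡ c → side o ≡ c
      side-of o = trans (sym (side-h o))

      origin-is-z : ∀ o → side o ≡ origin → h o ≡ z
      origin-is-z nothing         _  = refl
      origin-is-z (just (inj₁ _)) ()
      origin-is-z (just (inj₂ _)) ()

      z-neighbours : ∀ o → LGraph.E J nothing o → h o ≡ x₁ ⊎ h o ≡ x₂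
      z-neighbours (just (inj₁ _)) refl = inj₁ refl
      z-neighbours (just (inj₂ _)) refl = inj₂ refl

      z-neighbours′ : ∀ o → LGraph.E J o nothing → h o ≡ x₁ ⊎ h o ≡ x₂
      z-neighbours′ (just (inj₁ _)) refl = inj₁ refl
      z-neighbours′ (just (inj₂ _)) refl = inj₂ refl

      no-cross : ∀ o o′ → side o ≡ left → side o′ ≡ right → ¬ LGraph.E J o o′
      no-cross (just (inj₁ _)) (just (inj₂ _)) _ _ ()

      no-cross′ : ∀ o o′ → side o ≡ right → side o′ ≡ left → ¬ LGraph.E J o o′
      no-cross′ (just (inj₂ _)) (just (inj₁ _)) _ _ ()

    splitting : Splitting z s x₁ x₂
    splitting = record
      { z-origin      = side-h nothing
      ; origin-unique = via-h λ o e → origin-is-z o (side-of o e)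
      ; x₁-left       = side-h _
      ; x₂-right      = side-h _
      ; z→x₁          = Equivalence.to (h-adj _ _) refl
      ; z→x₂          = Equivalence.to (h-adj _ _) refl
      ; x₁→z          = Equivalence.to (h-adj _ _) refl
      ; x₂→z          = Equivalence.to (h-adj _ _) refl
      ; z→-only       = via-h λ o e → z-neighbours o (Equivalence.from (h-adj _ _) e)
      ; →z-only       = via-h λ o e → z-neighbours′ o (Equivalence.from (h-adj _ _) e)
      ; left↛right    = via-h λ o → via-h λ o′ eₒ eₒ′ →
                          ¬-not (no-cross o o′ (side-of o eₒ) (side-of o′ eₒ′) ∘ Equivalence.from (h-adj o o′))
      ; right↛left    = via-h λ o → via-h λ o′ eₒ eₒ′ →
                          ¬-not (no-cross′ o o′ (side-of o eₒ) (side-of o′ eₒ′) ∘ Equivalence.from (h-adj o o′))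
      ; z∉X           = Equivalence.from (h-lab nothing)
      ; x₁∈X          = Equivalence.to (h-lab _) y₁∈X
      ; x₂∈X          = Equivalence.to (h-lab _) y₂∈X
      }

    private
      module Component (c : Side) (S : LGraph) (ι : LGraph.V S → O) (ι-side : ∀ u → side (ι u) ≡ c)
                       (ι⁻¹ : ∀ o → side o ≡ c → LGraph.V S) (ι-ι⁻¹ : ∀ o e → ι (ι⁻¹ o e) ≡ o)
                       (ι-injective : ∀ {u v} → ι u ≡ ι v → u ≡ v)
                       (ι-adj : ∀ u v → LGraph.E S u v ⇔ LGraph.E J (ι u) (ι v))
                       (ι-lab : ∀ u → LGraph.X S u ⇔ LGraph.X J (ι u)) where
        v = select c s

        κ : LGraph.V S → Fin (count v)
        κ u = index v (h (ι u)) (selected c s _ (trans (side-h (ι u)) (ι-side u)))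

        κ⁻¹ : Fin (count v) → LGraph.V S
        κ⁻¹ a = ι⁻¹ (from β (embed v a))
                    (trans (sym (lookup∘tabulate (side ∘ from β) (embed v a))) (side-embed c s a))

        embed-κ : ∀ u → embed v (κ u) ≡ h (ι u)
        embed-κ u = embed-index v _ _

        κ⁻¹κ : ∀ u → κ⁻¹ (κ u) ≡ u
        κ⁻¹κ u = ι-injective (trans (ι-ι⁻¹ _ _) (trans (cong (from β) (embed-κ u)) (strictlyInverseʳ β (ι u))))

        κκ⁻¹ : ∀ a → κ (κ⁻¹ a) ≡ a
        κκ⁻¹ a = sym (embed≡⇒≡index v a _ (trans (sym (strictlyInverseˡ β _)) (cong h (sym (ι-ι⁻¹ _ _)))))

        κ-adj : ∀ u u′ → LGraph.E S u u′ ⇔ (g (embed v (κ u)) (embed v (κ u′)) ≡ true)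
        κ-adj u u′ = subst₂ (λ i j → LGraph.E S u u′ ⇔ (g i j ≡ true)) (sym (embed-κ u)) (sym (embed-κ u′))
                            (h-adj _ _ ⇔-∘ ι-adj u u′)

        κ-lab : ∀ u → LGraph.X S u ⇔ T (X (embed v (κ u)))
        κ-lab u = subst (λ i → LGraph.X S u ⇔ T (X i)) (sym (embed-κ u)) (h-lab _ ⇔-∘ ι-lab u)

        component-≅ₗ : S ≅ₗ part c s
        component-≅ₗ = record { iso = record { bij = mk↔ₛ′ κ κ⁻¹ κκ⁻¹ κ⁻¹κ ; adj = κ-adj } ; lab = κ-lab }

    left-≅ₗ : S¹ ≅ₗ part left s
    left-≅ₗ = Component.component-≅ₗ left S¹ (just ∘ inj₁) (λ _ → refl) from-left from-left-inverse
                (λ { refl → refl }) (λ _ _ → ⇔-id _) (λ _ → ⇔-id _)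
      where
      from-left : ∀ o → side o ≡ left → LGraph.V S¹
      from-left (just (inj₁ a)) _ = a
      from-left-inverse : ∀ o e → just (inj₁ (from-left o e)) ≡ o
      from-left-inverse (just (inj₁ a)) _ = refl

    right-≅ₗ : S² ≅ₗ part right s
    right-≅ₗ = Component.component-≅ₗ right S² (just ∘ inj₂) (λ _ → refl) from-right from-right-inverse
                 (λ { refl → refl }) (λ _ _ → ⇔-id _) (λ _ → ⇔-id _)
      where
      from-right : ∀ o → side o ≡ right → LGraph.V S²
      from-right (just (inj₂ b)) _ = b
      from-right-inverse : ∀ o e → just (inj₂ (from-right o e)) ≡ o
      from-right-inverse (just (inj₂ b)) _ = refl

∃-sides? : ∀ {ℓ m} {P : Vec Side m → Set ℓ} → (∀ s → Dec (P s)) → Dec (Σ (Vec Side m) P)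
∃-sides? {m = zero}  P? = map′ ([] ,_) (λ { ([] , p) → p }) (P? [])
∃-sides? {m = suc m} P? =
  map′ (λ { (inj₁ (s , p)) → _ , p ; (inj₂ (inj₁ (s , p))) → _ , p ; (inj₂ (inj₂ (s , p))) → _ , p })
       (λ { (origin ∷ s , p) → inj₁ (s , p) ; (left ∷ s , p) → inj₂ (inj₁ (s , p))
          ; (right ∷ s , p) → inj₂ (inj₂ (s , p)) })
       (∃-sides? (P? ∘ (origin ∷_)) ⊎-dec ∃-sides? (P? ∘ (left ∷_)) ⊎-dec ∃-sides? (P? ∘ (right ∷_)))

DecidableOnFinite : (LGraph → Set₁) → Set₁
DecidableOnFinite P = ∀ {m} (g : AdjMat m) X → Dec (P (labelled g X))

Invariant : (LGraph → Set₁) → Set₁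
Invariant P = ∀ {A B} → P A → A ≅ₗ B → P B

𝒮*? : ∀ {P Q} → Invariant P → Invariant Q → DecidableOnFinite P → DecidableOnFinite Q →
      DecidableOnFinite (𝒮* P Q)
𝒮*? {P} {Q} P-inv Q-inv P? Q? g X = map′ found⇒𝒮* 𝒮*⇒found
  (any? λ z → ∃-sides? λ s → any? λ x₁ → any? λ x₂ →
     splitting? g X z s x₁ x₂ ×-dec P? _ _ ×-dec Q? _ _)
  where
  found⇒𝒮* : _ → 𝒮* P Q (labelled g X)
  found⇒𝒮* (_ , _ , _ , _ , σ , p , q) = splitting⇒𝒮* g X P Q σ p q
  𝒮*⇒found : 𝒮* P Q (labelled g X) → _
  𝒮*⇒found (_ , _ , _ , _ , p , q , y₁∈X , y₂∈X , φ) =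
    _ , _ , _ , _ , splitting , P-inv p left-≅ₗ , Q-inv q right-≅ₗ
    where open ToSplitting g X φ y₁∈X y₂∈X

≅P₁? : ∀ {m} (g : AdjMat m) X → Dec (labelled g X ≅ₗ P₁)
≅P₁? {zero} g X = no λ φ → case from (bij (iso φ)) tt of λ ()
≅P₁? {suc (suc m)} g X = no λ φ → case to-injective (bij (iso φ)) {zero} {suc zero} refl of λ ()
≅P₁? {suc zero} g X with T? (X zero) | g zero zero ≟ᵇ true
... | no  0∉X | _       = no λ φ → 0∉X (Equivalence.from (lab φ zero) tt)
... | yes _   | yes 0→0 = no λ φ → Equivalence.to (adj (iso φ) zero zero) 0→0
... | yes 0∈X | no  0↛0 = yes record
  { iso = record { bij = mk↔ₛ′ _ (λ _ → zero) (λ _ → refl) (λ { zero → refl })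
                 ; adj = λ { zero zero → mk⇔ 0↛0 ⊥-elim } }
  ; lab = λ { zero → mk⇔ _ (λ _ → 0∈X) } }

-- recursion on k suffices: both parts of a member of S_{k+2} lie in S_i for i ≤ k + 1
mutual
  𝒮? : ∀ k → DecidableOnFinite (𝒮 k)
  𝒮? zero          g X = no lower
  𝒮? (suc zero)    g X = map′ lift lower (≅P₁? g X)
  𝒮? (suc (suc k)) g X =
    𝒮*? (𝒮-resp-≅ₗ (suc k)) (Below-resp-≅ₗ (suc (suc k))) (𝒮? (suc k)) (Below? (suc (suc k))) g X
    ×-dec ¬? (Below? (suc (suc k)) g X)

  Below? : ∀ k → DecidableOnFinite (Below k)
  Below? zero    g X = no lower
  Below? (suc k) g X = Below? k g X ⊎-dec 𝒮? k g X

-- Subdivisions as incidence graphs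

Original : ∀ {A B : Set} → A ⊎ B → Set
Original v = T (is-just (isInj₁ v))

incidence : (A B : Set) → (B → A) → (B → A) → LGraph
incidence A B e₁ e₂ = record { graph = record { V = A ⊎ B ; E = Inc } ; X = Original }
  where
  Inc : A ⊎ B → A ⊎ B → Set
  Inc (inj₁ w) (inj₂ b) = w ≡ e₁ b ⊎ w ≡ e₂ b
  Inc (inj₂ b) (inj₁ w) = w ≡ e₁ b ⊎ w ≡ e₂ b
  Inc (inj₁ _) (inj₁ _) = ⊥
  Inc (inj₂ _) (inj₂ _) = ⊥

subdivisionₗ : ∀ {n} → AdjMat n → LGraph
subdivisionₗ t = record { graph = Subdivision t ; X = Original }

Edge : ∀ {n} → AdjMat n → Set
Edge {n} t = Σ[ u ∈ Fin n ] Σ[ v ∈ Fin n ] (u <ᶠ v) × (t u v ≡ true)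

end₁ end₂ : ∀ {n} {t : AdjMat n} → Edge t → Fin n
end₁ (u , _)     = u
end₂ (_ , v , _) = v

subdivision-≅ₗ-incidence : ∀ {n} (t : AdjMat n) → subdivisionₗ t ≅ₗ incidence (Fin n) (Edge t) end₁ end₂
subdivision-≅ₗ-incidence t = record
  { iso = record { bij = mk↔ₛ′ id id (λ _ → refl) (λ _ → refl) ; adj = same-adj }
  ; lab = λ _ → ⇔-id _ }
  where
  same-adj : ∀ u v → Graph.E (Subdivision t) u v ⇔ LGraph.E (incidence _ _ end₁ end₂) u v
  same-adj (inj₁ _) (inj₁ _) = ⇔-id _
  same-adj (inj₁ _) (inj₂ _) = ⇔-id _
  same-adj (inj₂ _) (inj₁ _) = ⇔-id _
  same-adj (inj₂ _) (inj₂ _) = ⇔-id _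

SameEnds : ∀ {A : Set} → A → A → A → A → Set
SameEnds x y p q = (x ≡ p × y ≡ q) ⊎ (x ≡ q × y ≡ p)

SameEnds-refl : ∀ {A : Set} {x y : A} → SameEnds x y x y
SameEnds-refl = inj₁ (refl , refl)

SameEnds-sym : ∀ {A : Set} {x y p q : A} → SameEnds x y p q → SameEnds p q x y
SameEnds-sym (inj₁ (refl , refl)) = inj₁ (refl , refl)
SameEnds-sym (inj₂ (refl , refl)) = inj₂ (refl , refl)

SameEnds-trans : ∀ {A : Set} {x y p q r s : A} → SameEnds x y p q → SameEnds p q r s → SameEnds x y r s
SameEnds-trans (inj₁ (refl , refl)) h                    = h
SameEnds-trans (inj₂ (refl , refl)) (inj₁ (refl , refl)) = inj₂ (refl , refl)
SameEnds-trans (inj₂ (refl , refl)) (inj₂ (refl , refl)) = inj₁ (refl , refl)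

SameEnds-map : ∀ {A C : Set} (f : A → C) {x y p q : A} → SameEnds x y p q → SameEnds (f x) (f y) (f p) (f q)
SameEnds-map f (inj₁ (refl , refl)) = inj₁ (refl , refl)
SameEnds-map f (inj₂ (refl , refl)) = inj₂ (refl , refl)

record EdgeEnumeration {A B : Set} (r : A → A → Bool) (e₁ e₂ : B → A) : Set where
  field
    ends-adjacent : ∀ b → r (e₁ b) (e₂ b) ≡ true
    edge          : ∀ x y → r x y ≡ true → Σ[ b ∈ B ] SameEnds (e₁ b) (e₂ b) x y
    ends-unique   : ∀ b b′ → SameEnds (e₁ b) (e₂ b) (e₁ b′) (e₂ b′) → b ≡ b′

ordered-edge : ∀ {n} (t : AdjMat n) → IsSimple t → ∀ u v → t u v ≡ true →
               Σ[ ε ∈ Edge t ] SameEnds (end₁ ε) (end₂ ε) u v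
ordered-edge t (symmetric , loopless) u v e with <-cmp u v
... | tri< u<v _ _ = (u , v , u<v , e) , SameEnds-refl
... | tri≈ _ refl _ = case trans (sym e) (loopless u) of λ ()
... | tri> _ _ v<u = (v , u , v<u , trans (symmetric v u) e) , inj₂ (refl , refl)

edge-unique : ∀ {n} (t : AdjMat n) (ε ε′ : Edge t) → SameEnds (end₁ ε) (end₂ ε) (end₁ ε′) (end₂ ε′) → ε ≡ ε′
edge-unique t (u , v , u<v , e) (.u , .v , u<v′ , e′) (inj₁ (refl , refl))
  rewrite <-irrelevant u<v u<v′ | uip e e′ = refl
edge-unique t (u , v , u<v , _) (.v , .u , v<u , _) (inj₂ (refl , refl)) = ⊥-elim (<-asym u<v v<u)

edges-enumerate : ∀ {n} (t : AdjMat n) → IsSimple t → EdgeEnumeration t end₁ end₂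
edges-enumerate t simple = record
  { ends-adjacent = λ (_ , _ , _ , e) → e
  ; edge          = ordered-edge t simple
  ; ends-unique   = edge-unique t }

one-of-cong : ∀ {A : Set} {w x y p q : A} → SameEnds x y p q → (w ≡ x ⊎ w ≡ y) ⇔ (w ≡ p ⊎ w ≡ q)
one-of-cong (inj₁ (refl , refl)) = ⇔-id _
one-of-cong (inj₂ (refl , refl)) = mk⇔ swap⊎ swap⊎

one-of-map : ∀ {A C : Set} (f : A → C) → (∀ {x y} → f x ≡ f y → x ≡ y) →
             ∀ {w x y} → (w ≡ x ⊎ w ≡ y) ⇔ (f w ≡ f x ⊎ f w ≡ f y)
one-of-map f f-injective = mk⇔ (map⊎ (cong f) (cong f)) (map⊎ f-injective f-injective)

module _ {A A′ B B′ : Set} {e₁ e₂ : B → A} {f₁ f₂ : B′ → A′} (α : A ↔ A′) (β : B ↔ B′)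
         (β-ends : ∀ b → SameEnds (to α (e₁ b)) (to α (e₂ b)) (f₁ (to β b)) (f₂ (to β b))) where
  private
    F : A ⊎ B → A′ ⊎ B′
    F = map⊎ (to α) (to β)

    F⁻¹ : A′ ⊎ B′ → A ⊎ B
    F⁻¹ = map⊎ (from α) (from β)

    FF⁻¹ : ∀ y → F (F⁻¹ y) ≡ y
    FF⁻¹ (inj₁ w) = cong inj₁ (strictlyInverseˡ α w)
    FF⁻¹ (inj₂ b) = cong inj₂ (strictlyInverseˡ β b)

    F⁻¹F : ∀ x → F⁻¹ (F x) ≡ x
    F⁻¹F (inj₁ w) = cong inj₁ (strictlyInverseʳ α w)
    F⁻¹F (inj₂ b) = cong inj₂ (strictlyInverseʳ β b)

    F-adj : ∀ u v → LGraph.E (incidence A B e₁ e₂) u v ⇔ LGraph.E (incidence A′ B′ f₁ f₂) (F u) (F v)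
    F-adj (inj₁ w) (inj₂ b) = one-of-cong (β-ends b) ⇔-∘ one-of-map (to α) (to-injective α)
    F-adj (inj₂ b) (inj₁ w) = one-of-cong (β-ends b) ⇔-∘ one-of-map (to α) (to-injective α)
    F-adj (inj₁ _) (inj₁ _) = ⇔-id _
    F-adj (inj₂ _) (inj₂ _) = ⇔-id _

    F-lab : ∀ u → Original u ⇔ Original (F u)
    F-lab (inj₁ _) = ⇔-id _
    F-lab (inj₂ _) = ⇔-id _

  incidence-cong : incidence A B e₁ e₂ ≅ₗ incidence A′ B′ f₁ f₂
  incidence-cong = record { iso = record { bij = mk↔ₛ′ F F⁻¹ FF⁻¹ F⁻¹F ; adj = F-adj } ; lab = F-lab }

module _ {A A′ B B′ : Set} {r : A → A → Bool} {r′ : A′ → A′ → Bool} {e₁ e₂ : B → A} {f₁ f₂ : B′ → A′}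
         (α : A ↔ A′) (r≡r′ : ∀ x y → r x y ≡ r′ (to α x) (to α y))
         (E : EdgeEnumeration r e₁ e₂) (E′ : EdgeEnumeration r′ f₁ f₂) where
  private
    open EdgeEnumeration

    β-edge : ∀ b → Σ[ b′ ∈ B′ ] SameEnds (f₁ b′) (f₂ b′) (to α (e₁ b)) (to α (e₂ b))
    β-edge b = edge E′ _ _ (trans (sym (r≡r′ _ _)) (ends-adjacent E b))

    β⁻¹-edge : ∀ b′ → Σ[ b ∈ B ] SameEnds (e₁ b) (e₂ b) (from α (f₁ b′)) (from α (f₂ b′))
    β⁻¹-edge b′ = edge E _ _ (trans (r≡r′ _ _)
      (subst₂ (λ x y → r′ x y ≡ true) (sym (strictlyInverseˡ α _)) (sym (strictlyInverseˡ α _))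
              (ends-adjacent E′ b′)))

    β = proj₁ ∘ β-edge
    β⁻¹ = proj₁ ∘ β⁻¹-edge

    ββ⁻¹ : ∀ b′ → β (β⁻¹ b′) ≡ b′
    ββ⁻¹ b′ = ends-unique E′ _ _ (SameEnds-trans (proj₂ (β-edge _))
      (subst₂ (SameEnds _ _) (strictlyInverseˡ α _) (strictlyInverseˡ α _)
              (SameEnds-map (to α) (proj₂ (β⁻¹-edge b′)))))

    β⁻¹β : ∀ b → β⁻¹ (β b) ≡ b
    β⁻¹β b = ends-unique E _ _ (SameEnds-trans (proj₂ (β⁻¹-edge _))
      (subst₂ (SameEnds _ _) (strictlyInverseʳ α _) (strictlyInverseʳ α _)
              (SameEnds-map (from α) (proj₂ (β-edge b)))))

  enumerations-≅ₗ : incidence A B e₁ e₂ ≅ₗ incidence A′ B′ f₁ f₂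
  enumerations-≅ₗ = incidence-cong α (mk↔ₛ′ β β⁻¹ ββ⁻¹ β⁻¹β) (SameEnds-sym ∘ proj₂ ∘ β-edge)

module _ {A₁ A₂ B₁ B₂ : Set} (e₁ e₂ : B₁ → A₁) (f₁ f₂ : B₂ → A₂) (a : A₁) (b : A₂) where

  -- the origin vertex of the join becomes the new edge between a and b
  joined₁ joined₂ : Maybe (B₁ ⊎ B₂) → A₁ ⊎ A₂
  joined₁ nothing         = inj₁ a
  joined₁ (just (inj₁ c)) = inj₁ (e₁ c)
  joined₁ (just (inj₂ c)) = inj₂ (f₁ c)
  joined₂ nothing         = inj₂ b
  joined₂ (just (inj₁ c)) = inj₁ (e₂ c)
  joined₂ (just (inj₂ c)) = inj₂ (f₂ c)

  private
    J = join (incidence A₁ B₁ e₁ e₂) (incidence A₂ B₂ f₁ f₂) (inj₁ a) (inj₁ b)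
    K = incidence (A₁ ⊎ A₂) (Maybe (B₁ ⊎ B₂)) joined₁ joined₂

    F : LGraph.V J → LGraph.V K
    F nothing                 = inj₂ nothing
    F (just (inj₁ (inj₁ w)))  = inj₁ (inj₁ w)
    F (just (inj₁ (inj₂ c)))  = inj₂ (just (inj₁ c))
    F (just (inj₂ (inj₁ w)))  = inj₁ (inj₂ w)
    F (just (inj₂ (inj₂ c)))  = inj₂ (just (inj₂ c))

    F⁻¹ : LGraph.V K → LGraph.V J
    F⁻¹ (inj₂ nothing)          = nothing
    F⁻¹ (inj₁ (inj₁ w))         = just (inj₁ (inj₁ w))
    F⁻¹ (inj₂ (just (inj₁ c)))  = just (inj₁ (inj₂ c))
    F⁻¹ (inj₁ (inj₂ w))         = just (inj₂ (inj₁ w))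
    F⁻¹ (inj₂ (just (inj₂ c)))  = just (inj₂ (inj₂ c))

    FF⁻¹ : ∀ y → F (F⁻¹ y) ≡ y
    FF⁻¹ (inj₂ nothing)         = refl
    FF⁻¹ (inj₁ (inj₁ _))        = refl
    FF⁻¹ (inj₂ (just (inj₁ _))) = refl
    FF⁻¹ (inj₁ (inj₂ _))        = refl
    FF⁻¹ (inj₂ (just (inj₂ _))) = refl

    F⁻¹F : ∀ x → F⁻¹ (F x) ≡ x
    F⁻¹F nothing                = refl
    F⁻¹F (just (inj₁ (inj₁ _))) = refl
    F⁻¹F (just (inj₁ (inj₂ _))) = refl
    F⁻¹F (just (inj₂ (inj₁ _))) = refl
    F⁻¹F (just (inj₂ (inj₂ _))) = refl

    at-a : ∀ {w : A₁} → (inj₁ {B = B₁} w ≡ inj₁ a) ⇔ (inj₁ {B = A₂} w ≡ inj₁ a ⊎ inj₁ w ≡ inj₂ b)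
    at-a = mk⇔ (λ { refl → inj₁ refl }) (λ { (inj₁ refl) → refl })

    at-b : ∀ {w : A₂} → (inj₁ {B = B₂} w ≡ inj₁ b) ⇔ (inj₂ w ≡ inj₁ a ⊎ inj₂ {A = A₁} w ≡ inj₂ b)
    at-b = mk⇔ (λ { refl → inj₂ refl }) (λ { (inj₂ refl) → refl })

    not-at-a : ∀ {c : B₁} → (inj₂ {A = A₁} c ≡ inj₁ a) ⇔ ⊥
    not-at-a = mk⇔ (λ ()) ⊥-elim

    not-at-b : ∀ {c : B₂} → (inj₂ {A = A₂} c ≡ inj₁ b) ⇔ ⊥
    not-at-b = mk⇔ (λ ()) ⊥-elim

    in₁ : ∀ {w x y : A₁} → (w ≡ x ⊎ w ≡ y) ⇔ (inj₁ {B = A₂} w ≡ inj₁ x ⊎ inj₁ w ≡ inj₁ y)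
    in₁ = one-of-map inj₁ inj₁-injective

    in₂ : ∀ {w x y : A₂} → (w ≡ x ⊎ w ≡ y) ⇔ (inj₂ {A = A₁} w ≡ inj₂ x ⊎ inj₂ w ≡ inj₂ y)
    in₂ = one-of-map inj₂ inj₂-injective

    never₁₂ : ∀ {w : A₁} {x y : A₂} → ⊥ ⇔ (inj₁ w ≡ inj₂ x ⊎ inj₁ w ≡ inj₂ y)
    never₁₂ = mk⇔ ⊥-elim λ { (inj₁ ()) ; (inj₂ ()) }

    never₂₁ : ∀ {w : A₂} {x y : A₁} → ⊥ ⇔ (inj₂ w ≡ inj₁ x ⊎ inj₂ w ≡ inj₁ y)
    never₂₁ = mk⇔ ⊥-elim λ { (inj₁ ()) ; (inj₂ ()) }

    F-adj : ∀ u v → LGraph.E J u v ⇔ LGraph.E K (F u) (F v)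
    F-adj nothing                nothing                = ⇔-id _
    F-adj nothing                (just (inj₁ (inj₁ _))) = at-a
    F-adj nothing                (just (inj₁ (inj₂ _))) = not-at-a
    F-adj nothing                (just (inj₂ (inj₁ _))) = at-b
    F-adj nothing                (just (inj₂ (inj₂ _))) = not-at-b
    F-adj (just (inj₁ (inj₁ _))) nothing                = at-a
    F-adj (just (inj₁ (inj₂ _))) nothing                = not-at-a
    F-adj (just (inj₂ (inj₁ _))) nothing                = at-b
    F-adj (just (inj₂ (inj₂ _))) nothing                = not-at-b
    F-adj (just (inj₁ (inj₁ _))) (just (inj₁ (inj₁ _))) = ⇔-id _
    F-adj (just (inj₁ (inj₁ _))) (just (inj₁ (inj₂ _))) = in₁
    F-adj (just (inj₁ (inj₁ _))) (just (inj₂ (inj₁ _))) = ⇔-id _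
    F-adj (just (inj₁ (inj₁ _))) (just (inj₂ (inj₂ _))) = never₁₂
    F-adj (just (inj₁ (inj₂ _))) (just (inj₁ (inj₁ _))) = in₁
    F-adj (just (inj₁ (inj₂ _))) (just (inj₁ (inj₂ _))) = ⇔-id _
    F-adj (just (inj₁ (inj₂ _))) (just (inj₂ (inj₁ _))) = never₂₁
    F-adj (just (inj₁ (inj₂ _))) (just (inj₂ (inj₂ _))) = ⇔-id _
    F-adj (just (inj₂ (inj₁ _))) (just (inj₁ (inj₁ _))) = ⇔-id _
    F-adj (just (inj₂ (inj₁ _))) (just (inj₁ (inj₂ _))) = never₂₁
    F-adj (just (inj₂ (inj₁ _))) (just (inj₂ (inj₁ _))) = ⇔-id _
    F-adj (just (inj₂ (inj₁ _))) (just (inj₂ (inj₂ _))) = in₂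
    F-adj (just (inj₂ (inj₂ _))) (just (inj₁ (inj₁ _))) = never₁₂
    F-adj (just (inj₂ (inj₂ _))) (just (inj₁ (inj₂ _))) = ⇔-id _
    F-adj (just (inj₂ (inj₂ _))) (just (inj₂ (inj₁ _))) = in₂
    F-adj (just (inj₂ (inj₂ _))) (just (inj₂ (inj₂ _))) = ⇔-id _

    F-lab : ∀ u → LGraph.X J u ⇔ LGraph.X K (F u)
    F-lab nothing                = ⇔-id _
    F-lab (just (inj₁ (inj₁ _))) = ⇔-id _
    F-lab (just (inj₁ (inj₂ _))) = ⇔-id _
    F-lab (just (inj₂ (inj₁ _))) = ⇔-id _
    F-lab (just (inj₂ (inj₂ _))) = ⇔-id _

  join-incidence : J ≅ₗ K
  join-incidence = record { iso = record { bij = mk↔ₛ′ F F⁻¹ FF⁻¹ F⁻¹F ; adj = F-adj } ; lab = F-lab }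

SameEnds-injective : ∀ {A C : Set} (f : A → C) → (∀ {x y} → f x ≡ f y → x ≡ y) →
                     ∀ {x y p q} → SameEnds (f x) (f y) (f p) (f q) → SameEnds x y p q
SameEnds-injective f f-injective =
  map⊎ (map× f-injective f-injective) (map× f-injective f-injective)

glue : ∀ {n₁ n₂} → AdjMat n₁ → AdjMat n₂ → Fin n₁ → Fin n₂ → Fin n₁ ⊎ Fin n₂ → Fin n₁ ⊎ Fin n₂ → Bool
glue t₁ t₂ a b (inj₁ u) (inj₁ v) = t₁ u v
glue t₁ t₂ a b (inj₂ u) (inj₂ v) = t₂ u v
glue t₁ t₂ a b (inj₁ u) (inj₂ v) = isYes (u ≟ᶠ a) ∧ isYes (v ≟ᶠ b)
glue t₁ t₂ a b (inj₂ v) (inj₁ u) = isYes (u ≟ᶠ a) ∧ isYes (v ≟ᶠ b)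

bridge : ∀ {n₁ n₂} (a : Fin n₁) (b : Fin n₂) → isYes (a ≟ᶠ a) ∧ isYes (b ≟ᶠ b) ≡ true
bridge a b = Equivalence.to T-≡
  (Equivalence.from T-∧ (fromWitness {a? = a ≟ᶠ a} refl , fromWitness {a? = b ≟ᶠ b} refl))

bridge-only : ∀ {n₁ n₂} (a u : Fin n₁) (b v : Fin n₂) → isYes (u ≟ᶠ a) ∧ isYes (v ≟ᶠ b) ≡ true → u ≡ a × v ≡ b
bridge-only a u b v e =
  map× (toWitness {a? = u ≟ᶠ a}) (toWitness {a? = v ≟ᶠ b}) (Equivalence.to T-∧ (Equivalence.from T-≡ e))

module _ {n₁ n₂} {t₁ : AdjMat n₁} {t₂ : AdjMat n₂} {B₁ B₂ : Set} {e₁ e₂ : B₁ → Fin n₁} {f₁ f₂ : B₂ → Fin n₂}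
         (a : Fin n₁) (b : Fin n₂) (E₁ : EdgeEnumeration t₁ e₁ e₂) (E₂ : EdgeEnumeration t₂ f₁ f₂) where
  private
    open EdgeEnumeration
    g₁ = joined₁ e₁ e₂ f₁ f₂ a b
    g₂ = joined₂ e₁ e₂ f₁ f₂ a b

    adjacent : ∀ c → glue t₁ t₂ a b (g₁ c) (g₂ c) ≡ true
    adjacent nothing         = bridge a b
    adjacent (just (inj₁ c)) = ends-adjacent E₁ c
    adjacent (just (inj₂ c)) = ends-adjacent E₂ c

    edge-of : ∀ x y → glue t₁ t₂ a b x y ≡ true → Σ[ c ∈ Maybe (B₁ ⊎ B₂) ] SameEnds (g₁ c) (g₂ c) x y
    edge-of (inj₁ u) (inj₁ v) e = let (c , h) = edge E₁ u v e in just (inj₁ c) , SameEnds-map inj₁ h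
    edge-of (inj₂ u) (inj₂ v) e = let (c , h) = edge E₂ u v e in just (inj₂ c) , SameEnds-map inj₂ h
    edge-of (inj₁ u) (inj₂ v) e with bridge-only a u b v e
    ... | refl , refl = nothing , inj₁ (refl , refl)
    edge-of (inj₂ v) (inj₁ u) e with bridge-only a u b v e
    ... | refl , refl = nothing , inj₂ (refl , refl)

    unique : ∀ c c′ → SameEnds (g₁ c) (g₂ c) (g₁ c′) (g₂ c′) → c ≡ c′
    unique nothing          nothing          _ = refl
    unique (just (inj₁ c))  (just (inj₁ c′)) h =
      cong (just ∘ inj₁) (ends-unique E₁ c c′ (SameEnds-injective inj₁ inj₁-injective h))
    unique (just (inj₂ c))  (just (inj₂ c′)) h =
      cong (just ∘ inj₂) (ends-unique E₂ c c′ (SameEnds-injective inj₂ inj₂-injective h))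
    unique nothing          (just (inj₁ _))  (inj₁ (_ , ()))
    unique nothing          (just (inj₁ _))  (inj₂ (_ , ()))
    unique nothing          (just (inj₂ _))  (inj₁ (() , _))
    unique nothing          (just (inj₂ _))  (inj₂ (() , _))
    unique (just (inj₁ _))  nothing          (inj₁ (_ , ()))
    unique (just (inj₁ _))  nothing          (inj₂ (() , _))
    unique (just (inj₂ _))  nothing          (inj₁ (() , _))
    unique (just (inj₂ _))  nothing          (inj₂ (_ , ()))
    unique (just (inj₁ _))  (just (inj₂ _))  (inj₁ (() , _))
    unique (just (inj₁ _))  (just (inj₂ _))  (inj₂ (() , _))
    unique (just (inj₂ _))  (just (inj₁ _))  (inj₁ (() , _))
    unique (just (inj₂ _))  (just (inj₁ _))  (inj₂ (() , _))

  glued-enumeration : EdgeEnumeration (glue t₁ t₂ a b) g₁ g₂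
  glued-enumeration = record { ends-adjacent = adjacent ; edge = edge-of ; ends-unique = unique }

subdivision-glue : ∀ {n n₁ n₂} {t : AdjMat n} {t₁ : AdjMat n₁} {t₂ : AdjMat n₂} (a : Fin n₁) (b : Fin n₂) →
                   IsSimple t → IsSimple t₁ → IsSimple t₂ → (σ : Fin n ↔ (Fin n₁ ⊎ Fin n₂)) →
                   (∀ i j → t i j ≡ glue t₁ t₂ a b (to σ i) (to σ j)) →
                   subdivisionₗ t ≅ₗ join (subdivisionₗ t₁) (subdivisionₗ t₂) (inj₁ a) (inj₁ b)
subdivision-glue {t = t} {t₁} {t₂} a b simple simple₁ simple₂ σ t≡glue =
  ≅ₗ-trans (subdivision-≅ₗ-incidence t)
  (≅ₗ-trans (enumerations-≅ₗ σ t≡glue (edges-enumerate t simple)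
                              (glued-enumeration a b (edges-enumerate t₁ simple₁) (edges-enumerate t₂ simple₂)))
  (≅ₗ-trans (≅ₗ-sym (join-incidence end₁ end₂ end₁ end₂ a b))
            (≅ₗ-sym (join-cong (subdivision-≅ₗ-incidence t₁) (subdivision-≅ₗ-incidence t₂) (inj₁ a) (inj₁ b)))))

walk-++ : ∀ {G : Graph} {u v w} → Walk G u v → Walk G v w → Walk G u w
walk-++ here       q = q
walk-++ (step e p) q = step e (walk-++ p q)

walk-map : ∀ {G H : Graph} (f : Graph.V G → Graph.V H) → (∀ u v → Graph.E G u v → Graph.E H (f u) (f v)) →
           ∀ {u v} → Walk G u v → Walk H (f u) (f v)
walk-map f f-adj here       = here
walk-map f f-adj (step e p) = step (f-adj _ _ e) (walk-map f f-adj p)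

cycle-map : ∀ {G H : Graph} (f : Graph.V G → Graph.V H) → (∀ {x y} → f x ≡ f y → x ≡ y) →
            (∀ u v → Graph.E G u v → Graph.E H (f u) (f v)) → HasCycle G → HasCycle H
cycle-map {G} {H} f f-injective f-adj (v , vs , 2≤len , unique , linked) =
  f v , List.map f vs , subst (2 ≤_) (sym (length-map f vs)) 2≤len , Unique.map⁺ f-injective unique ,
  subst (Linked (Graph.E H)) (cong (f v ∷_) (map-++ f vs [ v ]))
        (Linked.map⁺ (Linked.map (λ {x} {y} → f-adj x y) linked))

linked-split : ∀ {A : Set} {R : A → A → Set} xs y ys →
               Linked R (xs ++ y ∷ ys) → Linked R (xs ++ [ y ]) × Linked R (y ∷ ys)
linked-split []            y ys l       = [-] , l
linked-split (x ∷ [])      y ys (r ∷ l) = (r ∷ [-]) , l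
linked-split (x ∷ x′ ∷ xs) y ys (r ∷ l) = map× (r ∷_) id (linked-split (x′ ∷ xs) y ys l)

linked-join : ∀ {A : Set} {R : A → A → Set} xs y ys →
              Linked R (xs ++ [ y ]) → Linked R (y ∷ ys) → Linked R (xs ++ y ∷ ys)
linked-join []            y ys l₁       l₂ = l₂
linked-join (x ∷ [])      y ys (r ∷ _)  l₂ = r ∷ l₂
linked-join (x ∷ x′ ∷ xs) y ys (r ∷ l₁) l₂ = r ∷ linked-join (x′ ∷ xs) y ys l₁ l₂

unique-resp-↭ : ∀ {A : Set} {xs ys : List A} → xs ↭ ys → Unique xs → Unique ys
unique-resp-↭ {A} p = Permutation.Unique-resp-↭ (setoid A) (↭⇒↭ₛ p)

record CycleAt (G : Graph) (w : Graph.V G) : Set where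
  field
    ws       : List (Graph.V G)
    2≤length : 2 ≤ length ws
    unique   : Unique (w ∷ ws)
    linked   : Linked (Graph.E G) (w ∷ ws ++ [ w ])

rotate : ∀ {G : Graph} v vs → 2 ≤ length vs → Unique (v ∷ vs) → Linked (Graph.E G) (v ∷ vs ++ [ v ]) →
         ∀ {w} → w ∈ v ∷ vs → Σ[ c ∈ CycleAt G w ] (∀ {y} → y ∈ v ∷ vs → y ∈ w ∷ CycleAt.ws c)
rotate {G} v vs 2≤len unique linked {w} w∈ with ∈-∃++ w∈
... | [] , Q , refl = record { ws = vs ; 2≤length = 2≤len ; unique = unique ; linked = linked } , id
... | (.v ∷ P) , Q , refl =
  record { ws = Q ++ v ∷ P ; 2≤length = 2≤len′ ; unique = unique-resp-↭ perm unique ; linked = linked′ } ,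
  ∈-resp-↭ perm
  where
  perm : (v ∷ P ++ w ∷ Q) ↭ (w ∷ Q ++ v ∷ P)
  perm = ++-comm (v ∷ P) (w ∷ Q)
  2≤len′ : 2 ≤ length (Q ++ v ∷ P)
  2≤len′ = subst (2 ≤_) (suc-injective (↭-length perm)) 2≤len
  halves : Linked (Graph.E G) ((v ∷ P) ++ [ w ]) × Linked (Graph.E G) (w ∷ Q ++ [ v ])
  halves = linked-split (v ∷ P) w (Q ++ [ v ])
             (subst (Linked (Graph.E G)) (cong (v ∷_) (++-assoc P (w ∷ Q) [ v ])) linked)
  linked′ : Linked (Graph.E G) (w ∷ (Q ++ v ∷ P) ++ [ w ])
  linked′ = subst (Linked (Graph.E G)) (cong (w ∷_) (sym (++-assoc Q (v ∷ P) [ w ])))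
              (linked-join (w ∷ Q) v (P ++ [ w ]) (proj₂ halves) (proj₁ halves))

-- Gluing two trees along a new edge gives a tree

Second : ∀ {A B : Set} → A ⊎ B → Set
Second v = T (is-just (isInj₂ v))

module _ {n₁ n₂} (t₁ : AdjMat n₁) (t₂ : AdjMat n₂) (a : Fin n₁) (b : Fin n₂) where

  Glued : Graph
  Glued = record { V = Fin n₁ ⊎ Fin n₂ ; E = λ x y → glue t₁ t₂ a b x y ≡ true }

  private
    V = Fin n₁ ⊎ Fin n₂
    E = Graph.E Glued

  bridge-ends : ∀ u v → glue t₁ t₂ a b (inj₁ u) (inj₂ v) ≡ true → u ≡ a × v ≡ b
  bridge-ends u v = bridge-only a u b v

  leaves-first-at-a : ∀ (x : V) xs ys → Linked E (x ∷ xs ++ ys) → Original x → Any Second xs → inj₁ a ∈ x ∷ xs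
  leaves-first-at-a (inj₁ u) (inj₂ w ∷ xs) ys (e ∷ _) _ _         = here (cong inj₁ (sym (proj₁ (bridge-ends u w e))))
  leaves-first-at-a (inj₁ u) (inj₁ w ∷ xs) ys (_ ∷ l) _ (there p) = there (leaves-first-at-a (inj₁ w) xs ys l _ p)

  leaves-second-at-b : ∀ (x : V) xs ys → Linked E (x ∷ xs ++ ys) → Second x → Any Original xs → inj₂ b ∈ x ∷ xs
  leaves-second-at-b (inj₂ u) (inj₁ w ∷ xs) ys (e ∷ _) _ _         = here (cong inj₂ (sym (proj₂ (bridge-ends w u e))))
  leaves-second-at-b (inj₂ u) (inj₂ w ∷ xs) ys (_ ∷ l) _ (there p) = there (leaves-second-at-b (inj₂ w) xs ys l _ p)

  -- a cycle through the bridge would have to cross it twice, and so visit inj₁ a twice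
  no-cycle-at-a : ∀ ws → 2 ≤ length ws → Unique (inj₁ a ∷ ws) → Linked E (inj₁ a ∷ ws ++ [ inj₁ a ]) →
                  ¬ Any Second ws
  no-cycle-at-a (inj₁ w ∷ ws) _ unique (_ ∷ linked) (there p) =
    Unique[x∷xs]⇒x∉xs unique (leaves-first-at-a (inj₁ w) ws [ inj₁ a ] linked _ p)
  no-cycle-at-a (inj₂ w ∷ []) (s≤s ())
  no-cycle-at-a (inj₂ w ∷ inj₁ u ∷ us) _ unique (_ ∷ e ∷ _) _ =
    Unique[x∷xs]⇒x∉xs unique (there (here (cong inj₁ (sym (proj₁ (bridge-ends u w e))))))
  no-cycle-at-a (inj₂ w ∷ inj₂ u ∷ us) _ (_ ∷ (w∉ ∷ _)) (e ∷ _ ∷ linked) _ with proj₂ (bridge-ends a w e)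
  ... | refl with leaves-second-at-b (inj₂ u) (us ++ [ inj₁ a ]) []
                    (subst (Linked E ∘ (inj₂ u ∷_)) (sym (++-identityʳ _)) linked) _ (++⁺ʳ us (here _))
  ...   | here eq = All¬⇒¬Any w∉ (here eq)
  ...   | there p with ∈-++⁻ us p
  ...     | inj₁ q = All¬⇒¬Any w∉ (there q)
  ...     | inj₂ (here ())

  no-mixed-cycle : ∀ x vs → 2 ≤ length vs → Unique (inj₁ x ∷ vs) → Linked E (inj₁ x ∷ vs ++ [ inj₁ x ]) →
                   ¬ Any Second vs
  no-mixed-cycle x vs 2≤len unique linked second =
    no-cycle-at-a ws 2≤length unique′ linked′ second′
    where
    rotated = rotate (inj₁ x) vs 2≤len unique linked (leaves-first-at-a (inj₁ x) vs [ inj₁ x ] linked _ second)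
    open CycleAt (proj₁ rotated) renaming (unique to unique′; linked to linked′)
    second′ : Any Second ws
    second′ with find second
    ... | y , y∈ , y-second with proj₂ rotated (there y∈)
    ...   | here refl = ⊥-elim y-second
    ...   | there q = lose q y-second

  all-first : ∀ (vs : List V) → ¬ Any Second vs → Σ[ us ∈ List (Fin n₁) ] List.map inj₁ us ≡ vs
  all-first []            _  = [] , refl
  all-first (inj₁ x ∷ vs) ¬s = map× (x ∷_) (cong (inj₁ x ∷_)) (all-first vs (¬s ∘ there))
  all-first (inj₂ y ∷ vs) ¬s = ⊥-elim (¬s (here _))

  no-cycle-from-first : ¬ HasCycle (toGraph t₁) → ∀ x vs → 2 ≤ length vs → Unique (inj₁ x ∷ vs) →
                        ¬ Linked E (inj₁ x ∷ vs ++ [ inj₁ x ])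
  no-cycle-from-first acyclic x vs 2≤len unique linked with Any.any? (T? ∘ is-just ∘ isInj₂) vs
  ... | yes second = no-mixed-cycle x vs 2≤len unique linked second
  ... | no ¬second with all-first vs ¬second
  ...   | us , refl = acyclic
          (x , us , subst (2 ≤_) (length-map inj₁ us) 2≤len , Unique.map⁻ unique ,
           Linked.map⁻ (subst (Linked E) (cong (inj₁ x ∷_) (sym (map-++ inj₁ us [ x ]))) linked))

module _ {n₁ n₂} {t₁ : AdjMat n₁} {t₂ : AdjMat n₂} (a : Fin n₁) (b : Fin n₂) where

  glue-swap : ∀ x y → glue t₁ t₂ a b x y ≡ true → glue t₂ t₁ b a (swap⊎ x) (swap⊎ y) ≡ true
  glue-swap (inj₁ _) (inj₁ _) e = e
  glue-swap (inj₂ _) (inj₂ _) e = e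
  glue-swap (inj₁ u) (inj₂ v) e = trans (∧-comm (isYes (v ≟ᶠ b)) (isYes (u ≟ᶠ a))) e
  glue-swap (inj₂ v) (inj₁ u) e = trans (∧-comm (isYes (v ≟ᶠ b)) (isYes (u ≟ᶠ a))) e

  glue-acyclic : ¬ HasCycle (toGraph t₁) → ¬ HasCycle (toGraph t₂) → ¬ HasCycle (Glued t₁ t₂ a b)
  glue-acyclic acyclic₁ _ (inj₁ x , vs , 2≤len , unique , linked) =
    no-cycle-from-first t₁ t₂ a b acyclic₁ x vs 2≤len unique linked
  glue-acyclic _ acyclic₂ cycle@(inj₂ y , _) =
    let (_ , vs , 2≤len , unique , linked) = cycle-map swap⊎ (to-injective swap-↔) glue-swap cycle
    in no-cycle-from-first t₂ t₁ b a acyclic₂ y vs 2≤len unique linked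

  glue-connected : Connected (toGraph t₁) → Connected (toGraph t₂) → Connected (Glued t₁ t₂ a b)
  glue-connected c₁ c₂ (inj₁ u) (inj₁ v) = walk-map inj₁ (λ _ _ e → e) (c₁ u v)
  glue-connected c₁ c₂ (inj₂ u) (inj₂ v) = walk-map inj₂ (λ _ _ e → e) (c₂ u v)
  glue-connected c₁ c₂ (inj₁ u) (inj₂ v) =
    walk-++ (glue-connected c₁ c₂ (inj₁ u) (inj₁ a)) (step (bridge a b) (glue-connected c₁ c₂ (inj₂ b) (inj₂ v)))
  glue-connected c₁ c₂ (inj₂ u) (inj₁ v) =
    walk-++ (glue-connected c₁ c₂ (inj₂ u) (inj₂ b)) (step (bridge a b) (glue-connected c₁ c₂ (inj₁ a) (inj₁ v)))

  glue-symmetric : (∀ u v → t₁ u v ≡ t₁ v u) → (∀ u v → t₂ u v ≡ t₂ v u) →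
                   ∀ x y → glue t₁ t₂ a b x y ≡ glue t₁ t₂ a b y x
  glue-symmetric sym₁ sym₂ (inj₁ u) (inj₁ v) = sym₁ u v
  glue-symmetric sym₁ sym₂ (inj₂ u) (inj₂ v) = sym₂ u v
  glue-symmetric sym₁ sym₂ (inj₁ _) (inj₂ _) = refl
  glue-symmetric sym₁ sym₂ (inj₂ _) (inj₁ _) = refl

  glue-loopless : (∀ u → t₁ u u ≡ false) → (∀ u → t₂ u u ≡ false) → ∀ x → glue t₁ t₂ a b x x ≡ false
  glue-loopless loopless₁ loopless₂ (inj₁ u) = loopless₁ u
  glue-loopless loopless₁ loopless₂ (inj₂ u) = loopless₂ u

  glue-tree : IsTree t₁ → IsTree t₂ → ∀ {n} (t : AdjMat n) (σ : Fin n ↔ (Fin n₁ ⊎ Fin n₂)) →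
              (∀ i j → t i j ≡ glue t₁ t₂ a b (to σ i) (to σ j)) → IsTree t
  glue-tree ((sym₁ , loopless₁) , _ , connected₁ , acyclic₁) ((sym₂ , loopless₂) , _ , connected₂ , acyclic₂)
            {n} t σ t≡glue =
    (symmetric , loopless) , nonempty (from σ (inj₁ a)) , connected , acyclic
    where
    symmetric : ∀ i j → t i j ≡ t j i
    symmetric i j = trans (t≡glue i j) (trans (glue-symmetric sym₁ sym₂ (to σ i) (to σ j)) (sym (t≡glue j i)))
    loopless : ∀ i → t i i ≡ false
    loopless i = trans (t≡glue i i) (glue-loopless loopless₁ loopless₂ (to σ i))
    nonempty : Fin n → 1 ≤ n
    nonempty zero    = s≤s z≤n
    nonempty (suc _) = s≤s z≤n
    from-adj : ∀ x y → glue t₁ t₂ a b x y ≡ true → t (from σ x) (from σ y) ≡ true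
    from-adj x y e = trans (t≡glue _ _)
      (subst₂ (λ p q → glue t₁ t₂ a b p q ≡ true) (sym (strictlyInverseˡ σ x)) (sym (strictlyInverseˡ σ y)) e)
    connected : Connected (toGraph t)
    connected i j = subst₂ (Walk (toGraph t)) (strictlyInverseʳ σ i) (strictlyInverseʳ σ j)
      (walk-map (from σ) from-adj (glue-connected connected₁ connected₂ (to σ i) (to σ j)))
    acyclic : ¬ HasCycle (toGraph t)
    acyclic = glue-acyclic acyclic₁ acyclic₂
            ∘ cycle-map (to σ) (to-injective σ) (λ u v e → trans (sym (t≡glue u v)) e)

-- Every member of S is the subdivision of a tree

SubdivisionOfTree : LGraph → Set
SubdivisionOfTree A = Σ[ n ∈ ℕ ] Σ[ t ∈ AdjMat n ] IsTree t × (A ≅ₗ subdivisionₗ t)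

K₁ : AdjMat 1
K₁ _ _ = false

K₁-tree : IsTree K₁
K₁-tree = ((λ _ _ → refl) , (λ _ → refl)) , s≤s z≤n , (λ { zero zero → here }) , no-cycle
  where
  no-cycle : ¬ HasCycle (toGraph K₁)
  no-cycle (_ , _ ∷ _ , _ , _ , () ∷ _)

subdivision-≅ₗ-P₁ : (t : AdjMat 1) → subdivisionₗ t ≅ₗ P₁
subdivision-≅ₗ-P₁ t = record
  { iso = record { bij = mk↔ₛ′ _ (λ _ → inj₁ zero) (λ _ → refl) only-vertex ; adj = no-edge }
  ; lab = λ { (inj₁ zero) → ⇔-id _ ; (inj₂ (zero , zero , () , _)) } }
  where
  only-vertex : ∀ v → inj₁ zero ≡ v
  only-vertex (inj₁ zero)                 = refl
  only-vertex (inj₂ (zero , zero , () , _))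
  no-edge : ∀ u v → Graph.E (Subdivision t) u v ⇔ ⊥
  no-edge (inj₁ zero)                   (inj₁ zero)                   = ⇔-id _
  no-edge (inj₁ zero)                   (inj₂ (zero , zero , () , _))
  no-edge (inj₂ (zero , zero , () , _)) _

glue-trees : ∀ {n₁ n₂} {t₁ : AdjMat n₁} {t₂ : AdjMat n₂} (a : Fin n₁) (b : Fin n₂) → IsTree t₁ → IsTree t₂ →
             Σ[ t ∈ AdjMat (n₁ + n₂) ] IsTree t ×
               (subdivisionₗ t ≅ₗ join (subdivisionₗ t₁) (subdivisionₗ t₂) (inj₁ a) (inj₁ b))
glue-trees {n₁} {t₁ = t₁} {t₂} a b T₁ T₂ =
  t , t-tree , subdivision-glue a b (proj₁ t-tree) (proj₁ T₁) (proj₁ T₂) +↔⊎ λ _ _ → refl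
  where
  t : AdjMat (n₁ + _)
  t i j = glue t₁ t₂ a b (splitAt n₁ i) (splitAt n₁ j)
  t-tree : IsTree t
  t-tree = glue-tree a b T₁ T₂ t +↔⊎ λ _ _ → refl

original-inj₁ : ∀ {A B : Set} (v : A ⊎ B) → Original v → Σ[ a ∈ A ] v ≡ inj₁ a
original-inj₁ (inj₁ a) _ = a , refl

join-cong-at : ∀ {S¹ T¹ S² T² x¹ x² y¹ y²} (p : S¹ ≅ₗ T¹) (q : S² ≅ₗ T²) →
               to (bij (iso p)) x¹ ≡ y¹ → to (bij (iso q)) x² ≡ y² →
               join S¹ S² x¹ x² ≅ₗ join T¹ T² y¹ y²
join-cong-at p q refl refl = join-cong p q _ _

join-subdivisions : ∀ {S¹ S² x¹ x²} → LGraph.X S¹ x¹ → LGraph.X S² x² →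
                    SubdivisionOfTree S¹ → SubdivisionOfTree S² → SubdivisionOfTree (join S¹ S² x¹ x²)
join-subdivisions {x¹ = x¹} {x²} x¹∈X x²∈X (n₁ , t₁ , T₁ , ψ₁) (n₂ , t₂ , T₂ , ψ₂) =
  let a , x¹↦a = original-inj₁ _ (Equivalence.to (lab ψ₁ x¹) x¹∈X)
      b , x²↦b = original-inj₁ _ (Equivalence.to (lab ψ₂ x²) x²∈X)
      t , t-tree , ξ = glue-trees a b T₁ T₂
  in n₁ + n₂ , t , t-tree , ≅ₗ-trans (join-cong-at ψ₁ ψ₂ x¹↦a x²↦b) (≅ₗ-sym ξ)

mutual
  𝒮⇒subdivision : ∀ k {A} → 𝒮 k A → SubdivisionOfTree A
  𝒮⇒subdivision (suc zero) (lift A≅P₁) = 1 , K₁ , K₁-tree , ≅ₗ-trans A≅P₁ (≅ₗ-sym (subdivision-≅ₗ-P₁ K₁))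
  𝒮⇒subdivision (suc (suc k)) ((_ , _ , _ , _ , s¹ , s² , x¹∈X , x²∈X , A≅J) , _) =
    let n , t , t-tree , ψ =
          join-subdivisions x¹∈X x²∈X (𝒮⇒subdivision (suc k) s¹) (Below⇒subdivision (suc (suc k)) s²)
    in n , t , t-tree , ≅ₗ-trans A≅J ψ

  Below⇒subdivision : ∀ k {A} → Below k A → SubdivisionOfTree A
  Below⇒subdivision (suc k) (inj₁ b) = Below⇒subdivision k b
  Below⇒subdivision (suc k) (inj₂ s) = 𝒮⇒subdivision k s

unique-lookup-injective : ∀ {A : Set} {xs : List A} → Unique xs →
                          ∀ {i j} → List.lookup xs i ≡ List.lookup xs j → i ≡ j
unique-lookup-injective (_  ∷ _)   {zero}  {zero}  _ = refl
unique-lookup-injective (x∉ ∷ _)   {zero}  {suc j} e = ⊥-elim (All.lookup x∉ (∈-lookup j) e)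
unique-lookup-injective (x∉ ∷ _)   {suc i} {zero}  e = ⊥-elim (All.lookup x∉ (∈-lookup i) (sym e))
unique-lookup-injective (_  ∷ xs!) {suc i} {suc j} e = cong suc (unique-lookup-injective xs! e)

unique-length≤ : ∀ {m} {xs : List (Fin m)} → Unique xs → length xs ≤ m
unique-length≤ unique = injective⇒≤ (unique-lookup-injective unique)

unique-prefix : ∀ {A : Set} (xs : List A) {ys} → Unique (xs ++ ys) → Unique xs
unique-prefix []       _           = []
unique-prefix (x ∷ xs) (x∉ ∷ xs!) = ++⁻ˡ xs x∉ ∷ unique-prefix xs xs!

Leaf : ∀ {m} → AdjMat m → Set
Leaf {m} t = Σ[ l ∈ Fin m ] Σ[ p ∈ Fin m ] (t l p ≡ true) × (∀ w → t l w ≡ true → w ≡ p)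

module _ {m} {t : AdjMat m} (tree : IsTree t) where
  open import Data.List.Membership.DecPropositional (_≟ᶠ_ {m}) using (_∈?_)

  private
    E = Graph.E (toGraph t)
    symmetric = proj₁ (proj₁ tree)
    loopless  = proj₂ (proj₁ tree)
    acyclic   = proj₂ (proj₂ (proj₂ tree))

  -- the path is extended away from its previous vertex until it ends in a leaf; it cannot outgrow the m vertices
  extend-path : ∀ fuel c prev rest → Unique (c ∷ prev ∷ rest) → Linked E (c ∷ prev ∷ rest) →
                m < fuel + length (c ∷ prev ∷ rest) → Leaf t
  extend-path zero c prev rest unique _ m<len = ⊥-elim (<⇒≱ m<len (unique-length≤ unique))
  extend-path (suc fuel) c prev rest unique linked@(c→prev ∷ _) m<len
    with any? (λ w → (t c w ≟ᵇ true) ×-dec ¬? (w ≟ᶠ prev))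
  ... | no no-other = c , prev , c→prev , only-prev
    where
    only-prev : ∀ w → t c w ≡ true → w ≡ prev
    only-prev w c→w with w ≟ᶠ prev
    ... | yes w≡prev = w≡prev
    ... | no  w≢prev = ⊥-elim (no-other (w , c→w , w≢prev))
  ... | yes (w , c→w , w≢prev) with w ∈? (c ∷ prev ∷ rest)
  ...   | no w∉ = extend-path fuel w c (prev ∷ rest) (¬Any⇒All¬ _ w∉ ∷ unique) (w→c ∷ linked)
                    (subst (m <_) (sym (+-suc fuel _)) m<len)
    where w→c = trans (symmetric w c) c→w
  ...   | yes (here refl) = case trans (sym c→w) (loopless c) of λ ()
  ...   | yes (there (here w≡prev)) = ⊥-elim (w≢prev w≡prev)
  ...   | yes (there (there w∈rest)) with ∈-∃++ w∈rest
  ...     | P , Q , refl = ⊥-elim (acyclic (w , c ∷ prev ∷ P , s≤s (s≤s z≤n) , cycle-unique , cycle-linked))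
    where
    cycle-unique : Unique (w ∷ c ∷ prev ∷ P)
    cycle-unique = unique-prefix (w ∷ c ∷ prev ∷ P) (unique-resp-↭ (shift w (c ∷ prev ∷ P) Q) unique)
    cycle-linked : Linked E (w ∷ (c ∷ prev ∷ P) ++ [ w ])
    cycle-linked = trans (symmetric w c) c→w ∷ proj₁ (linked-split (c ∷ prev ∷ P) w Q linked)

leaf-exists : ∀ {n} {t : AdjMat (suc (suc n))} → IsTree t → Leaf t
leaf-exists {n} {t} tree@((symmetric , loopless) , _ , connected , _) with connected zero (suc zero)
... | step {v = v} 0→v _ =
  extend-path tree (suc (suc n)) v zero [] ((v≢0 ∷ []) ∷ [] ∷ []) (trans (symmetric v zero) 0→v ∷ [-])
              (m<m+n (suc (suc n)) (s≤s z≤n))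
  where
  v≢0 : v ≢ zero
  v≢0 refl = case trans (sym 0→v) (loopless zero) of λ ()

module _ {n} {t : AdjMat (suc (suc n))} (tree : IsTree t) {l p : Fin (suc (suc n))}
         (l→p : t l p ≡ true) (leaf : ∀ w → t l w ≡ true → w ≡ p) where
  private
    symmetric = proj₁ (proj₁ tree)
    loopless  = proj₂ (proj₁ tree)
    connected = proj₁ (proj₂ (proj₂ tree))
    acyclic   = proj₂ (proj₂ (proj₂ tree))

    l≢p : l ≢ p
    l≢p refl = case trans (sym l→p) (loopless l) of λ ()

  pruned : AdjMat (suc n)
  pruned i j = t (punchIn l i) (punchIn l j)

  pruned-parent : Fin (suc n)
  pruned-parent = punchOut l≢p

  private
    -- a walk entering the leaf l must leave it back to the vertex it came from
    avoid-leaf : ∀ {x y} → Walk (toGraph t) x y → (l≢x : l ≢ x) (l≢y : l ≢ y) →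
                 Walk (toGraph pruned) (punchOut l≢x) (punchOut l≢y)
    avoid-leaf here l≢x l≢y = subst (Walk (toGraph pruned) (punchOut l≢x)) (punchOut-cong l refl) here
    avoid-leaf (step {v = v} x→v w) l≢x l≢y with l ≟ᶠ v
    ... | no l≢v = step (subst₂ (λ a b → t a b ≡ true) (sym (punchIn-punchOut l≢x)) (sym (punchIn-punchOut l≢v)) x→v)
                        (avoid-leaf w l≢v l≢y)
    ... | yes refl with w
    ...   | here = ⊥-elim (l≢y refl)
    ...   | step {v = v′} l→v′ w′ =
      subst (λ z → Walk (toGraph pruned) z (punchOut l≢y)) (punchOut-cong l v′≡x) (avoid-leaf w′ l≢v′ l≢y)
      where
      v′≡x : v′ ≡ _
      v′≡x = trans (leaf v′ l→v′) (sym (leaf _ (trans (symmetric l _) x→v)))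
      l≢v′ : l ≢ v′
      l≢v′ eq = l≢x (trans eq v′≡x)

  pruned-tree : IsTree pruned
  pruned-tree =
    ((λ _ _ → symmetric _ _) , (λ _ → loopless _)) , s≤s z≤n ,
    (λ i j → subst₂ (Walk (toGraph pruned)) (punchOut-punchIn l) (punchOut-punchIn l)
               (avoid-leaf (connected (punchIn l i) (punchIn l j)) _ _)) ,
    acyclic ∘ cycle-map (punchIn l) (punchIn-injective l _ _) (λ _ _ e → e)

  private
    σ→ : Fin (suc (suc n)) → Fin (suc n) ⊎ Fin 1
    σ→ x with l ≟ᶠ x
    ... | yes _   = inj₂ zero
    ... | no  l≢x = inj₁ (punchOut l≢x)

    σ← : Fin (suc n) ⊎ Fin 1 → Fin (suc (suc n))
    σ← (inj₁ j)    = punchIn l j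
    σ← (inj₂ zero) = l

    σ→← : ∀ y → σ→ (σ← y) ≡ y
    σ→← (inj₁ j) with l ≟ᶠ punchIn l j
    ... | yes l≡ = ⊥-elim (punchInᵢ≢i l j (sym l≡))
    ... | no  _  = cong inj₁ (trans (punchOut-cong l refl) (punchOut-punchIn l))
    σ→← (inj₂ zero) with l ≟ᶠ l
    ... | yes _   = refl
    ... | no  l≢l = ⊥-elim (l≢l refl)

    σ←→ : ∀ x → σ← (σ→ x) ≡ x
    σ←→ x with l ≟ᶠ x
    ... | yes l≡x = l≡x
    ... | no  l≢x = punchIn-punchOut l≢x

    σ : Fin (suc (suc n)) ↔ (Fin (suc n) ⊎ Fin 1)
    σ = mk↔ₛ′ σ→ σ← σ→← σ←→

    adjacent-to-leaf : ∀ i (l≢i : l ≢ i) → (t i l ≡ true) ⇔ (isYes (punchOut l≢i ≟ᶠ pruned-parent) ∧ true ≡ true)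
    adjacent-to-leaf i l≢i =
      subst (λ b → (t i l ≡ true) ⇔ (b ≡ true)) (sym (∧-identityʳ _))
        (mk⇔ (λ i→l → Equivalence.to T-≡ (fromWitness (punchOut-cong l (leaf i (trans (symmetric l i) i→l)))))
             (λ e → subst (λ z → t z l ≡ true) (sym (punchOut-injective l≢i l≢p (toWitness (Equivalence.from T-≡ e))))
                          (trans (symmetric p l) l→p)))

    t≡glue : ∀ i j → t i j ≡ glue pruned K₁ pruned-parent zero (σ→ i) (σ→ j)
    t≡glue i j with l ≟ᶠ i | l ≟ᶠ j
    ... | no l≢i | no l≢j  = sym (cong₂ t (punchIn-punchOut l≢i) (punchIn-punchOut l≢j))
    ... | no l≢i | yes refl = ⇔→≡ (adjacent-to-leaf i l≢i)
    ... | yes refl | no l≢j = trans (symmetric l j) (⇔→≡ (adjacent-to-leaf j l≢j))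
    ... | yes refl | yes refl = loopless l

  prune-≅ₗ : subdivisionₗ t ≅ₗ join (subdivisionₗ pruned) (subdivisionₗ K₁) (inj₁ pruned-parent) (inj₁ zero)
  prune-≅ₗ = subdivision-glue pruned-parent zero (proj₁ tree) (proj₁ pruned-tree) (proj₁ K₁-tree) σ t≡glue

-- Every subdivision of a tree is a member of S

P₁∈Below : ∀ k {A} → 𝒮 1 A → Below (suc (suc k)) A
P₁∈Below zero    s = inj₂ s
P₁∈Below (suc k) s = inj₁ (P₁∈Below k s)

Below⇒𝒮 : ∀ k {A} → Below k A → Σ[ i ∈ ℕ ] 𝒮 i A
Below⇒𝒮 (suc k) (inj₁ below) = Below⇒𝒮 k below
Below⇒𝒮 (suc k) (inj₂ s)     = k , s

-- membership in S_{k+2} also requires not lying in a lower S_i, which is decidable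
𝒮*⇒𝒮 : ∀ k {m} (g : AdjMat m) X → 𝒮* (𝒮 (suc k)) (Below (suc (suc k))) (labelled g X) →
       Σ[ i ∈ ℕ ] 𝒮 i (labelled g X)
𝒮*⇒𝒮 k g X s* with Below? (suc (suc k)) g X
... | yes below = Below⇒𝒮 _ below
... | no ¬below = suc (suc k) , s* , ¬below

add-pendant : ∀ k {m} (g : AdjMat m) X {S x} → 𝒮 k S → LGraph.X S x →
              labelled g X ≅ₗ join S (subdivisionₗ K₁) x (inj₁ zero) → Σ[ i ∈ ℕ ] 𝒮 i (labelled g X)
add-pendant (suc k) g X s x∈X ψ =
  𝒮*⇒𝒮 k g X (_ , _ , _ , _ , s , P₁∈Below k (lift (subdivision-≅ₗ-P₁ K₁)) , x∈X , _ , ψ)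

-- stated for finite labelled copies of S(t), the graphs on which membership in S_k is decidable
Subdivisions⊆𝒮 : ℕ → Set₁
Subdivisions⊆𝒮 n = ∀ {t : AdjMat n} → IsTree t → ∀ {m} (g : AdjMat m) X →
                   labelled g X ≅ₗ subdivisionₗ t → Σ[ k ∈ ℕ ] 𝒮 k (labelled g X)

prune-step : ∀ {n} → Subdivisions⊆𝒮 (suc n) → Subdivisions⊆𝒮 (suc (suc n))
prune-step IH tree g X φ with leaf-exists tree
... | _ , _ , l→p , is-leaf =
  add-pendant (proj₁ pruned∈𝒮) g X (𝒮-resp-≅ₗ _ (proj₂ pruned∈𝒮) (≅ₗ-sym pruned≅part)) _ ψ
  where
  ψ = ≅ₗ-trans φ (prune-≅ₗ tree l→p is-leaf)
  pruned≅part = ToSplitting.left-≅ₗ g X ψ _ _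
  pruned∈𝒮 = IH (pruned-tree tree l→p is-leaf) _ _ (≅ₗ-sym pruned≅part)

subdivision⇒𝒮 : ∀ n → Subdivisions⊆𝒮 n
subdivision⇒𝒮 zero          (_ , () , _)
subdivision⇒𝒮 (suc zero)    {t} _ g X φ = 1 , lift (≅ₗ-trans φ (subdivision-≅ₗ-P₁ t))
subdivision⇒𝒮 (suc (suc n)) = prune-step (subdivision⇒𝒮 (suc n))

proposition12 : (m : ℕ) (g : AdjMat m) → IsSimple g → In𝒮 g ⇔ IsSubdivOfTree g
proposition12 m g _ = mk⇔ forward backward
  where
  forward : In𝒮 g → IsSubdivOfTree g
  forward (k , X , s) = let n , t , t-tree , ψ = 𝒮⇒subdivision k s in n , t , t-tree , iso ψ
  backward : IsSubdivOfTree g → In𝒮 g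
  backward (n , t , t-tree , φ) =
    let k , s = subdivision⇒𝒮 n t-tree g (is-just ∘ isInj₁ ∘ to (bij φ)) record { iso = φ ; lab = λ _ → ⇔-id _ }
    in k , _ , s
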